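{- If all the $\mathsf{ai}$-paths in a cycle-free atomic flow $B$ are clean paths, then there exists an atomic flow $C$ in which no $\mathsf{ai}$-connections appear and such that $B\to_{\mathsf{ex}}C$.
   Context: An atomic flow is a finite directed acyclic graph whose vertices are labelled interaction (0 upper edges, 2 lower edges), cointeraction (2 upper, 0 lower), weakening (0,1), coweakening (1,0), contraction (2,1) or cocontraction (1,2); edges may have a dangling upper end (upper edges of the flow) or dangling lower end (lower edges of the flow); there is a polarity assignment in $\{+,-\}$ with equal polarities on the edges of a (co)contraction and distinct ones on the two edges of a (co)interaction. A path is a sequence of edges $\epsilon_1,\dots,\epsilon_h$ with the lower end of $\epsilon_i$ equal to the upper end of $\epsilon_{i+1}$, or the reverse. An $\mathsf{ai}$-path is a path or (recursively) the concatenation $\epsilon_1,\dots,\epsilon_k,\epsilon_{k+1},\dots,\epsilon_h$ of an $\mathsf{ai}$-path ending at an interaction or cointeraction vertex $\nu$ with an $\mathsf{ai}$-path starting at $\nu$, $\epsilon_k\neq\epsilon_{k+1}$; it is maximal if no $\mathsf{ai}$-path containing its edges is longer. An $\mathsf{ai}$-cycle is an $\mathsf{ai}$-path from a vertex to itself with no repeated edge; cycle-free means no $\mathsf{ai}$-cycle. An $\mathsf{ai}$-connection is a path from an interaction vertex to a cointeraction vertex or vice versa; a simple edge is an $\mathsf{ai}$-connection of length one. A clean path is an $\mathsf{ai}$-path in which every $\mathsf{ai}$-connection is a simple edge. A simple edge $\epsilon_k$ is extremal if there is a maximal $\mathsf{ai}$-path $\epsilon_1,\dots,\epsilon_k,\dots,\epsilon_h$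 which is a clean path and in which $\epsilon_{k+1},\dots,\epsilon_h$ are not simple edges. Construction: let $B$ have a simple edge $\epsilon_1$ from an interaction $\nu$ (other lower edge $\epsilon_2$) to a cointeraction $\mu$ (other upper edge $\epsilon_3$). Let $A$ be $B$ minus $\nu,\mu,\epsilon_1$; let $e_1,\dots,e_h$ be the upper and $e'_1,\dots,e'_k$ the lower edges of $B$. With disjoint copies $\tilde A,\hat A$ of $A$, let $B'$ be $\tilde A$ plus a new weakening with lower edge $\tilde\epsilon_2$, and $B''$ be $\hat A$ plus a new coweakening with upper edge $\hat\epsilon_3$. For flows $D',D''$ with the same upper and lower edges as $B',B''$, $\mathrm{Comb}(D',D'')$ is their disjoint union with $\tilde\epsilon_3$ and $\hat\epsilon_2$ identified into one edge, plus for each $i\le h$ a new cocontraction with upper edge $e_i$ and lower edges $\tilde e_i,\hat e_i$, and for each $j\le k$ a new contraction with upper edges $\tilde e'_j,\hat e'_j$ and lower edge $e'_j$. The relation $\to_{\mathsf{ex}}$ is defined inductively: if $B$ has no extremal simple edge then $B\to_{\mathsf{ex}}B$; if $\epsilon_1$ is an extremal simple edge of $B$, $B'\to_{\mathsf{ex}}D'$ and $B''\to_{\mathsf{ex}}D''$, then $B\to_{\mathsf{ex}}\mathrm{Comb}(D',D'')$. -}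

module Defs where

open import Level using (Level)
open import Data.Bool using (Bool; true; false; not; _∨_; T)
open import Data.Unit using (⊤; tt)
open import Data.Empty using (⊥; ⊥-elim)
open import Data.Nat using (ℕ; zero; suc; _≤_)
open import Data.Fin using (Fin)
open import Data.Maybe using (Maybe; just; nothing)
open import Data.Sum using (_⊎_; inj₁; inj₂; [_,_]′)
open import Data.Product using (Σ; _×_; _,_; proj₁; proj₂; ∃)
open import Data.List using (List; []; _∷_; _++_; map; length; reverse; _∷ʳ_)
open import Data.List.Relation.Unary.All using (All)
open import Data.List.Relation.Unary.Linked using (Linked)
open import Data.List.Relation.Unary.Unique.Propositional using (Unique)
open import Data.List.Membership.Propositional using (_∈_)
open import Relation.Nullary using (¬_; Dec; yes; no; does)
open import Relation.Binary.PropositionalEquality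
  using (_≡_; _≢_; refl; sym; trans; cong; subst)
open import Relation.Binary.Definitions using (DecidableEquality)

data Kind : Set where
  int coint wk cowk ctr coctr : Kind

nUp : Kind → ℕ
nUp int   = 0
nUp coint = 2
nUp wk    = 0
nUp cowk  = 1
nUp ctr   = 2
nUp coctr = 1

nLow : Kind → ℕ
nLow int   = 2
nLow coint = 0
nLow wk    = 1
nLow cowk  = 0
nLow ctr   = 1
nLow coctr = 2

data Pol : Set where
  pos neg : Pol

-- H indexes the upper edges of the flow and K its lower edges.
-- Each edge has an upper end  (up e)  which is either a vertex or the
-- i-th upper dangling position (inj₂ i), and a lower end (lo e) which is
-- either a vertex or the j-th lower dangling position.  An edge e has
-- the vertex v as its upper end iff e is a lower edge of v.

record Flow (H K : Set) : Set₁ where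
  field
    V E   : Set
    kind  : V → Kind
    up    : E → V ⊎ H
    lo    : E → V ⊎ K
    pol   : E → Pol
    inp   : H → E
    out   : K → E
    inpUp : ∀ i → up (inp i) ≡ inj₂ i
    outLo : ∀ j → lo (out j) ≡ inj₂ j

Exactly : (A : Set) → (A → Set) → ℕ → Set
Exactly A P n =
  Σ (Fin n → A) λ f →
    (∀ {x y} → f x ≡ f y → x ≡ y) × (∀ x → P (f x)) × (∀ a → P a → ∃ λ x → f x ≡ a)

Finite : Set → Set
Finite A = Σ ℕ λ n → Exactly A (λ _ → ⊤) n

module _ {H K : Set} (F : Flow H K) where
  open Flow F

  Incident : E → V → Set
  Incident e v = (up e ≡ inj₁ v) ⊎ (lo e ≡ inj₁ v)

  Below : E → E → Set
  Below e e' = Σ V λ v → lo e ≡ inj₁ v × up e' ≡ inj₁ v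

  DirectedCycle : List E → Set
  DirectedCycle [] = ⊥
  DirectedCycle (e ∷ es) =
    Linked Below (e ∷ es) × Σ E λ l → Σ (List E) λ ys → (e ∷ es) ≡ ys ∷ʳ l × Below l e

  record IsFlow : Set where
    field
      finV     : Finite V
      finE     : Finite E
      inpUniq  : ∀ e i → up e ≡ inj₂ i → e ≡ inp i
      outUniq  : ∀ e j → lo e ≡ inj₂ j → e ≡ out j
      upperDeg : ∀ v → Exactly E (λ e → lo e ≡ inj₁ v) (nUp (kind v))
      lowerDeg : ∀ v → Exactly E (λ e → up e ≡ inj₁ v) (nLow (kind v))
      acyclic  : ∀ es → ¬ DirectedCycle es
      polCtr   : ∀ v → (kind v ≡ ctr ⊎ kind v ≡ coctr) →
                 ∀ e e' → Incident e v → Incident e' v → pol e ≡ pol e'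
      polInt   : ∀ v → (kind v ≡ int ⊎ kind v ≡ coint) →
                 ∀ e e' → Incident e v → Incident e' v → e ≢ e' → pol e ≢ pol e'

  -- ai-paths, represented as oriented walks: (e , down) traverses e from
  -- its upper end to its lower end, (e , upw) the other way round.

  data Dir : Set where
    down upw : Dir

  vtx : {X : Set} → V ⊎ X → Maybe V
  vtx (inj₁ v) = just v
  vtx (inj₂ _) = nothing

  src tgt : E × Dir → Maybe V
  src (e , down) = vtx (up e)
  src (e , upw)  = vtx (lo e)
  tgt (e , down) = vtx (lo e)
  tgt (e , upw)  = vtx (up e)

  -- condition at the shared vertex v of consecutive edges: either the
  -- direction is kept (ordinary path step) or it changes at an
  -- interaction (going up then down) or a cointeraction (down then up),
  -- with distinct edges (concatenation of ai-paths).
  Turn : Dir → Dir → V → E → E → Set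
  Turn down down v e e' = ⊤
  Turn upw  upw  v e e' = ⊤
  Turn upw  down v e e' = kind v ≡ int × e ≢ e'
  Turn down upw  v e e' = kind v ≡ coint × e ≢ e'

  Link : E × Dir → E × Dir → Set
  Link (e , d) (e' , d') =
    Σ V λ v → tgt (e , d) ≡ just v × src (e' , d') ≡ just v × Turn d d' v e e'

  AiPath : List (E × Dir) → Set
  AiPath []      = ⊥
  AiPath (x ∷ w) = Linked Link (x ∷ w)

  edges : List (E × Dir) → List E
  edges = map proj₁

  StartsAt : V → List (E × Dir) → Set
  StartsAt v []      = ⊥
  StartsAt v (x ∷ _) = src x ≡ just v

  EndsAt : V → List (E × Dir) → Set
  EndsAt v w = Σ (List (E × Dir)) λ ys → Σ (E × Dir) λ x → w ≡ ys ∷ʳ x × tgt x ≡ just v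

  AiCycle : List (E × Dir) → Set
  AiCycle w = AiPath w × Unique (edges w) × Σ V λ v → StartsAt v w × EndsAt v w

  CycleFree : Set
  CycleFree = ∀ w → ¬ AiCycle w

  MaximalAiPath : List (E × Dir) → Set
  MaximalAiPath w = AiPath w ×
    (∀ w' → AiPath w' → (∀ {e} → e ∈ edges w → e ∈ edges w') → length w' ≤ length w)

  DownConn : List E → Set
  DownConn [] = ⊥
  DownConn (e ∷ es) =
    Linked Below (e ∷ es) ×
    (Σ V λ ν → up e ≡ inj₁ ν × kind ν ≡ int) ×
    (Σ E λ l → Σ (List E) λ ys → (e ∷ es) ≡ ys ∷ʳ l ×
       Σ V λ μ → lo l ≡ inj₁ μ × kind μ ≡ coint)

  AiConnection : List E → Set
  AiConnection es = DownConn es ⊎ DownConn (reverse es)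

  SimpleEdge : E → Set
  SimpleEdge e = AiConnection (e ∷ [])

  NoAiConnection : Set
  NoAiConnection = ∀ es → ¬ AiConnection es

  -- every ai-connection occurring (contiguously) in the path is a simple edge
  CleanPath : List (E × Dir) → Set
  CleanPath w = AiPath w ×
    (∀ xs s ys → edges w ≡ xs ++ s ++ ys → AiConnection s → length s ≡ 1)

  AllClean : Set
  AllClean = ∀ w → AiPath w → CleanPath w

  Extremal : E → Set
  Extremal e = SimpleEdge e ×
    Σ (List (E × Dir)) λ pre → Σ Dir λ d → Σ (List (E × Dir)) λ post →
      MaximalAiPath (pre ++ (e , d) ∷ post) ×
      CleanPath (pre ++ (e , d) ∷ post) ×
      All (λ x → ¬ SimpleEdge (proj₁ x)) post

Keep : (A : Set) → (A → Bool) → Set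
Keep A p = Σ A λ a → T (p a)

record Redex {H K : Set} (B : Flow H K) : Set where
  open Flow B
  field
    decV : DecidableEquality V
    decE : DecidableEquality E
    ν μ : V
    ε₁ ε₂ ε₃ : E
    νint : kind ν ≡ int
    μco  : kind μ ≡ coint
    ε₁up : up ε₁ ≡ inj₁ ν
    ε₁lo : lo ε₁ ≡ inj₁ μ
    ε₂up : up ε₂ ≡ inj₁ ν
    ε₂≢  : ε₂ ≢ ε₁
    ε₃lo : lo ε₃ ≡ inj₁ μ
    ε₃≢  : ε₃ ≢ ε₁

neqT : {A : Set} {x y : A} (d : Dec (x ≡ y)) → x ≢ y → T (not (does d))
neqT (yes p) ne = ⊥-elim (ne p)
neqT (no _)  ne = tt

inj₂≢inj₁ : {A B : Set} {a : A} {b : B} → inj₂ b ≢ inj₁ a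
inj₂≢inj₁ ()

module Split {H K : Set} (B : Flow H K) (r : Redex B) where
  open Flow B
  open Redex r

  gone : V → Bool
  gone v = does (decV v ν) ∨ does (decV v μ)

  -- vertices and edges of A = B minus ν, μ, ε₁
  VA : Set
  VA = Keep V (λ v → not (gone v))

  EA : Set
  EA = Keep E (λ e → not (does (decE e ε₁)))

  cl : (v : V) (b : Bool) → b ≡ gone v → VA ⊎ ⊤
  cl v true  _  = inj₂ tt
  cl v false eq = inj₁ (v , subst (λ b → T (not b)) eq tt)

  classify : V → VA ⊎ ⊤
  classify v = cl v (gone v) refl

  cl-true : ∀ v b (eq : b ≡ gone v) → b ≡ true → cl v b eq ≡ inj₂ tt
  cl-true v .true eq refl = refl

  classify-gone : ∀ v → gone v ≡ true → classify v ≡ inj₂ tt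
  classify-gone v g = cl-true v (gone v) refl g

  goneν : gone ν ≡ true
  goneν with decV ν ν
  ... | yes _ = refl
  ... | no ¬p = ⊥-elim (¬p refl)

  goneμ : gone μ ≡ true
  goneμ with decV μ ν
  ... | yes _ = refl
  ... | no _ with decV μ μ
  ...   | yes _ = refl
  ...   | no ¬p = ⊥-elim (¬p refl)

  inp≢ : ∀ i → inp i ≢ ε₁
  inp≢ i eq = inj₂≢inj₁ (trans (sym (inpUp i)) (trans (cong up eq) ε₁up))

  out≢ : ∀ j → out j ≢ ε₁
  out≢ j eq = inj₂≢inj₁ (trans (sym (outLo j)) (trans (cong lo eq) ε₁lo))

  mkE : (e : E) → e ≢ ε₁ → EA
  mkE e ne = e , neqT (decE e ε₁) ne

  -- B' : Ã plus a weakening above ε̃₂; ε̃₃ becomes an extra lower edge.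
  -- (Ends of edges that were attached to the removed vertices ν, μ are
  -- attached to the new weakening (upper ends) / the new lower position
  -- (lower ends); in an atomic flow these are exactly ε₂ resp. ε₃.)
  up' : EA → (VA ⊎ ⊤) ⊎ H
  up' (e , _) = [ (λ v → [ (λ a → inj₁ (inj₁ a)) , (λ _ → inj₁ (inj₂ tt)) ]′ (classify v)) , inj₂ ]′ (up e)

  lo' : EA → (VA ⊎ ⊤) ⊎ (K ⊎ ⊤)
  lo' (e , _) = [ (λ v → [ (λ a → inj₁ (inj₁ a)) , (λ _ → inj₂ (inj₂ tt)) ]′ (classify v)) , (λ j → inj₂ (inj₁ j)) ]′ (lo e)

  kind' : VA ⊎ ⊤ → Kind
  kind' (inj₁ (v , _)) = kind v
  kind' (inj₂ _)       = wk

  out' : K ⊎ ⊤ → EA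
  out' (inj₁ j) = mkE (out j) (out≢ j)
  out' (inj₂ _) = mkE ε₃ ε₃≢

  inpUp' : ∀ i → up' (mkE (inp i) (inp≢ i)) ≡ inj₂ i
  inpUp' i rewrite inpUp i = refl

  outLo' : ∀ j → lo' (out' j) ≡ inj₂ j
  outLo' (inj₁ j) rewrite outLo j = refl
  outLo' (inj₂ tt) rewrite ε₃lo | classify-gone μ goneμ = refl

  B' : Flow H (K ⊎ ⊤)
  B' = record
    { V = VA ⊎ ⊤ ; E = EA ; kind = kind'
    ; up = up' ; lo = lo' ; pol = λ e → pol (proj₁ e)
    ; inp = λ i → mkE (inp i) (inp≢ i) ; out = out'
    ; inpUp = inpUp' ; outLo = outLo' }

  up'' : EA → (VA ⊎ ⊤) ⊎ (H ⊎ ⊤)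
  up'' (e , _) = [ (λ v → [ (λ a → inj₁ (inj₁ a)) , (λ _ → inj₂ (inj₂ tt)) ]′ (classify v)) , (λ i → inj₂ (inj₁ i)) ]′ (up e)

  lo'' : EA → (VA ⊎ ⊤) ⊎ K
  lo'' (e , _) = [ (λ v → [ (λ a → inj₁ (inj₁ a)) , (λ _ → inj₁ (inj₂ tt)) ]′ (classify v)) , inj₂ ]′ (lo e)

  kind'' : VA ⊎ ⊤ → Kind
  kind'' (inj₁ (v , _)) = kind v
  kind'' (inj₂ _)       = cowk

  inp'' : H ⊎ ⊤ → EA
  inp'' (inj₁ i) = mkE (inp i) (inp≢ i)
  inp'' (inj₂ _) = mkE ε₂ ε₂≢

  inpUp'' : ∀ i → up'' (inp'' i) ≡ inj₂ i
  inpUp'' (inj₁ i) rewrite inpUp i = refl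
  inpUp'' (inj₂ tt) rewrite ε₂up | classify-gone ν goneν = refl

  outLo'' : ∀ j → lo'' (mkE (out j) (out≢ j)) ≡ inj₂ j
  outLo'' j rewrite outLo j = refl

  B'' : Flow (H ⊎ ⊤) K
  B'' = record
    { V = VA ⊎ ⊤ ; E = EA ; kind = kind''
    ; up = up'' ; lo = lo'' ; pol = λ e → pol (proj₁ e)
    ; inp = inp'' ; out = λ j → mkE (out j) (out≢ j)
    ; inpUp = inpUp'' ; outLo = outLo'' }

-- Comb(D', D''): disjoint union, ε̃₃ (lower position inj₂ tt of D') and
-- ε̂₂ (upper position inj₂ tt of D'') identified into one edge (we keep
-- the D'-edge and drop the D''-edge(s) starting at that position), plus
-- a cocontraction for each upper edge and a contraction for each lower
-- edge.
module CombM {H K : Set} (D' : Flow H (K ⊎ ⊤)) (D'' : Flow (H ⊎ ⊤) K) where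
  module P = Flow D'
  module Q = Flow D''

  isSlot : Q.V ⊎ (H ⊎ ⊤) → Bool
  isSlot (inj₂ (inj₂ _)) = true
  isSlot _               = false

  CV : Set
  CV = P.V ⊎ Q.V ⊎ H ⊎ K     -- H: cocontractions, K: contractions

  CE : Set
  CE = P.E ⊎ Keep Q.E (λ e → not (isSlot (Q.up e))) ⊎ H ⊎ K

  ckind : CV → Kind
  ckind (inj₁ v)               = P.kind v
  ckind (inj₂ (inj₁ v))        = Q.kind v
  ckind (inj₂ (inj₂ (inj₁ _))) = coctr
  ckind (inj₂ (inj₂ (inj₂ _))) = ctr

  loQ : Q.V ⊎ K → CV
  loQ (inj₁ v) = inj₂ (inj₁ v)
  loQ (inj₂ j) = inj₂ (inj₂ (inj₂ j))

  upQ : (x : Q.V ⊎ (H ⊎ ⊤)) → T (not (isSlot x)) → CV ⊎ H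
  upQ (inj₁ v)        _ = inj₁ (inj₂ (inj₁ v))
  upQ (inj₂ (inj₁ i)) _ = inj₁ (inj₂ (inj₂ (inj₁ i)))
  upQ (inj₂ (inj₂ _)) ()

  cup : CE → CV ⊎ H
  cup (inj₁ e) = [ (λ v → inj₁ (inj₁ v)) , (λ i → inj₁ (inj₂ (inj₂ (inj₁ i)))) ]′ (P.up e)
  cup (inj₂ (inj₁ (e , t))) = upQ (Q.up e) t
  cup (inj₂ (inj₂ (inj₁ i))) = inj₂ i
  cup (inj₂ (inj₂ (inj₂ j))) = inj₁ (inj₂ (inj₂ (inj₂ j)))

  loP : P.V ⊎ (K ⊎ ⊤) → CV
  loP (inj₁ v)        = inj₁ v
  loP (inj₂ (inj₁ j)) = inj₂ (inj₂ (inj₂ j))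
  loP (inj₂ (inj₂ _)) = loQ (Q.lo (Q.inp (inj₂ tt)))

  clo : CE → CV ⊎ K
  clo (inj₁ e)               = inj₁ (loP (P.lo e))
  clo (inj₂ (inj₁ (e , _)))  = inj₁ (loQ (Q.lo e))
  clo (inj₂ (inj₂ (inj₁ i))) = inj₁ (inj₂ (inj₂ (inj₁ i)))
  clo (inj₂ (inj₂ (inj₂ j))) = inj₂ j

  cpol : CE → Pol
  cpol (inj₁ e)               = P.pol e
  cpol (inj₂ (inj₁ (e , _)))  = Q.pol e
  cpol (inj₂ (inj₂ (inj₁ i))) = P.pol (P.inp i)
  cpol (inj₂ (inj₂ (inj₂ j))) = Q.pol (Q.out j)

  Comb : Flow H K
  Comb = record
    { V = CV ; E = CE ; kind = ckind ; up = cup ; lo = clo ; pol = cpol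
    ; inp = λ i → inj₂ (inj₂ (inj₁ i)) ; out = λ j → inj₂ (inj₂ (inj₂ j))
    ; inpUp = λ i → refl ; outLo = λ j → refl }

open CombM using (Comb) public

data _→ex_ : {H K : Set} → Flow H K → Flow H K → Set₁ where
  noExtremal : ∀ {H K} {B : Flow H K} →
    (∀ e → ¬ Extremal B e) → B →ex B
  split : ∀ {H K} {B : Flow H K} (r : Redex B) →
    Extremal B (Redex.ε₁ r) →
    ∀ {D' D''} → Split.B' B r →ex D' → Split.B'' B r →ex D'' →
    B →ex Comb D' D''

module Submission where

-- Theorem 5.12, by induction on the number of edges of B.  Without simple
-- edges, C = B: a directed path from an interaction to a cointeraction is
-- an ai-path, hence clean, hence a simple edge, so there is none.  Otherwise
-- a simple edge is extended to a maximal ai-path (ai-paths of a cycle-free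
-- flow repeat no edge, so exhaustive search terminates) whose last simple
-- edge is extremal.  Splitting at it gives B' and B'', which embed into B,
-- hence are cycle-free, clean and smaller: B' →ex D', B'' →ex D''.  A
-- directed connection of Comb(D', D'') lies in D', in D'', or crosses the
-- identified edge ε̃₃ = ε̂₂.  The induction carries the invariant that
-- directed interface paths of the result are traced by ai-walks of the
-- input; a crossing then makes both ε₂ and ε₃ simple edges of B, which
-- extremality of ε₁ forbids.

open import Defs
open import Function using (_∘_)
open import Data.Bool using (Bool; true; false; not; T)
open import Data.Bool.Properties using (T-irrelevant)
open import Data.Unit using (⊤; tt)
import Data.Unit.Properties as ⊤
open import Data.Empty using (⊥; ⊥-elim)
open import Data.Nat using (ℕ; zero; suc; _≤_; _<_; z≤n; s≤s; _+_; _<?_)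
open import Data.Nat.Properties
  using (≤-refl; ≤-trans; ≤-pred; 1+n≰n; m≤n⇒m≤1+n; m≤n+m; +-identityʳ; +-suc; +-monoˡ-≤; ≮⇒≥)
open import Data.Fin using (Fin; zero; suc)
import Data.Fin as Fin
open import Data.Maybe using (Maybe; just; nothing)
import Data.Maybe.Properties as Maybe
open import Data.Sum using (_⊎_; inj₁; inj₂; [_,_]′)
open import Data.Sum.Properties using (inj₁-injective; inj₂-injective)
import Data.Sum.Properties as Sum
open import Data.Product using (Σ; _×_; _,_; proj₁; proj₂; ∃)
open import Data.List
  using (List; []; _∷_; _++_; map; length; reverse; _∷ʳ_; lookup; drop; allFin; concatMap; deduplicate)
open import Data.List.Properties using (map-++; ++-identityʳ; reverse-map; length-map; length-++-sucʳ)
open import Data.List.Relation.Unary.Any using (Any; here; there; index; any?; satisfied)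
open import Data.List.Relation.Unary.Any.Properties using (lookup-index)
open import Data.List.Relation.Unary.All using (All; []; _∷_; all?)
import Data.List.Relation.Unary.All as All
import Data.List.Relation.Unary.All.Properties as AllP
open import Data.List.Relation.Unary.All.Properties.Core using (¬Any⇒All¬)
open import Data.List.Relation.Unary.AllPairs using ([]; _∷_)
open import Data.List.Relation.Unary.Linked using (Linked; []; [-]; _∷_)
import Data.List.Relation.Unary.Linked as Linked
import Data.List.Relation.Unary.Linked.Properties as LinkedP
open import Data.List.Relation.Unary.Unique.Propositional using (Unique)
import Data.List.Relation.Unary.Unique.Propositional.Properties as Unique
import Data.List.Relation.Unary.Unique.DecPropositional.Properties as UniqueDec
open import Data.List.Membership.Propositional using (_∈_; lose)
open import Data.List.Membership.Propositional.Properties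
  using (∈-map⁺; ∈-map⁻; ∈-++⁺ˡ; ∈-++⁺ʳ; ∈-++⁻; ∈-∃++; ∈-lookup; ∈-allFin; ∈-concatMap⁺; ∈-deduplicate⁺)
import Data.List.Membership.DecPropositional as DecMembership
open import Relation.Nullary using (¬_; Dec; yes; no)
open import Relation.Binary.PropositionalEquality
  using (_≡_; _≢_; refl; sym; trans; cong; subst)
open import Relation.Binary.Definitions using (DecidableEquality)

-- Finite types and exact counting

Keep-≡ : {A : Set} {p : A → Bool} {a b : Keep A p} → proj₁ a ≡ proj₁ b → a ≡ b
Keep-≡ {p = p} {a , x} {.a , y} refl = cong (a ,_) (T-irrelevant x y)

Listable : Set → Set
Listable A = Σ (List A) λ xs → ∀ a → a ∈ xs

finite⇒decEq : {A : Set} → Finite A → DecidableEquality A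
finite⇒decEq (n , f , _ , _ , onto) a b with proj₁ (onto a tt) Fin.≟ proj₁ (onto b tt)
... | yes p = yes (trans (sym (proj₂ (onto a tt))) (trans (cong f p) (proj₂ (onto b tt))))
... | no np = no λ { refl → np refl }

finite⇒listable : {A : Set} → Finite A → Listable A
finite⇒listable (n , f , _ , _ , onto) = map f (allFin n) , λ a →
  subst (_∈ map f (allFin n)) (proj₂ (onto a tt)) (∈-map⁺ f (∈-allFin (proj₁ (onto a tt))))

lookup-injective : {A : Set} (xs : List A) → Unique xs → ∀ {i j} → lookup xs i ≡ lookup xs j → i ≡ j
lookup-injective (x ∷ xs) u {zero} {zero} e = refl
lookup-injective (x ∷ xs) (px ∷ u) {zero} {suc j} e = ⊥-elim (All.lookup px (∈-lookup j) e)
lookup-injective (x ∷ xs) (px ∷ u) {suc i} {zero} e = ⊥-elim (All.lookup px (∈-lookup i) (sym e))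
lookup-injective (x ∷ xs) (px ∷ u) {suc i} {suc j} e = cong suc (lookup-injective xs u e)

listable⇒finite : {A : Set} → DecidableEquality A → Listable A → Finite A
listable⇒finite {A} _≟_ (xs , all∈) =
  length ys , lookup ys , lookup-injective ys (UniqueDec.deduplicate-! _≟_ xs) , (λ _ → tt) ,
  λ a _ → index (cover a) , sym (lookup-index (cover a))
  where
  ys : List A
  ys = deduplicate _≟_ xs
  cover : ∀ a → a ∈ ys
  cover a = ∈-deduplicate⁺ _≟_ (all∈ a)

listable-⊎ : {A B : Set} → Listable A → Listable B → Listable (A ⊎ B)
listable-⊎ (xs , cx) (ys , cy) = map inj₁ xs ++ map inj₂ ys ,
  λ { (inj₁ a) → ∈-++⁺ˡ (∈-map⁺ inj₁ (cx a)) ; (inj₂ b) → ∈-++⁺ʳ (map inj₁ xs) (∈-map⁺ inj₂ (cy b)) }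

listable-⊤ : Listable ⊤
listable-⊤ = tt ∷ [] , λ { tt → here refl }

listable-image : {A B : Set} → Listable A → (g : A → List B) → (∀ b → Σ A λ a → b ∈ g a) → Listable B
listable-image (xs , cx) g cover =
  concatMap g xs , λ b → ∈-concatMap⁺ g (lose (cx (proj₁ (cover b))) (proj₂ (cover b)))

keepOne : {A : Set} (p : A → Bool) (a : A) (b : Bool) → p a ≡ b → List (Keep A p)
keepOne p a true  eq = (a , subst T (sym eq) tt) ∷ []
keepOne p a false eq = []

keepOne-∈ : {A : Set} (p : A → Bool) (k : Keep A p) (b : Bool) (eq : p (proj₁ k) ≡ b) →
  k ∈ keepOne p (proj₁ k) b eq
keepOne-∈ p k true  eq = here (Keep-≡ refl)
keepOne-∈ p (a , t) false eq = ⊥-elim (subst T eq t)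

listable-Keep : {A : Set} (p : A → Bool) → Listable A → Listable (Keep A p)
listable-Keep p l = listable-image l (λ a → keepOne p a (p a) refl)
  λ k → proj₁ k , keepOne-∈ p k (p (proj₁ k)) refl

decEq-Keep : {A : Set} (p : A → Bool) → DecidableEquality A → DecidableEquality (Keep A p)
decEq-Keep p _≟_ a b with proj₁ a ≟ proj₁ b
... | yes e = yes (Keep-≡ e)
... | no n = no λ e → n (cong proj₁ e)

Exactly-push : {A B : Set} {P : A → Set} {Q : B → Set} {n : ℕ} → Exactly A P n →
  (to : A → B) → (∀ a → P a → Q (to a)) → (∀ a a' → P a → P a' → to a ≡ to a' → a ≡ a') →
  (∀ b → Q b → Σ A λ a → P a × to a ≡ b) → Exactly B Q n
Exactly-push (f , inj , pf , onto) to pq to-inj cover =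
  (λ x → to (f x)) , (λ e → inj (to-inj _ _ (pf _) (pf _) e)) , (λ x → pq _ (pf x)) ,
  λ b qb → let (a , pa , ta) = cover b qb ; (x , fx) = onto a pa in x , trans (cong to fx) ta

Exactly-pull : {A B : Set} {P : A → Set} {Q : B → Set} {n : ℕ} → Exactly A P n →
  (from : B → A) → (∀ b → Q b → P (from b)) → (∀ b b' → Q b → Q b' → from b ≡ from b' → b ≡ b') →
  (∀ a → P a → Σ B λ b → Q b × from b ≡ a) → Exactly B Q n
Exactly-pull {B = B} {Q = Q} {n} (f , inj , pf , onto) from qp from-inj cover =
  g , (λ {x} {y} e → inj (trans (sym (g-from x)) (trans (cong from e) (g-from y)))) , g-Q ,
  λ b qb → let (x , fx) = onto (from b) (qp b qb) in x , from-inj _ b (g-Q x) qb (trans (g-from x) fx)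
  where
  g : Fin n → B
  g x = proj₁ (cover (f x) (pf x))
  g-Q : ∀ x → Q (g x)
  g-Q x = proj₁ (proj₂ (cover (f x) (pf x)))
  g-from : ∀ x → from (g x) ≡ f x
  g-from x = proj₂ (proj₂ (cover (f x) (pf x)))

Exactly-0 : {A : Set} {P : A → Set} → Exactly A P 0 → ∀ a → ¬ P a
Exactly-0 (f , _ , _ , onto) a pa with onto a pa
... | () , _

fin2-cases : (i j k : Fin 2) → i ≢ j → (k ≡ i) ⊎ (k ≡ j)
fin2-cases zero zero k ne = ⊥-elim (ne refl)
fin2-cases zero (suc zero) zero ne = inj₁ refl
fin2-cases zero (suc zero) (suc zero) ne = inj₂ refl
fin2-cases (suc zero) zero zero ne = inj₂ refl
fin2-cases (suc zero) zero (suc zero) ne = inj₁ refl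
fin2-cases (suc zero) (suc zero) k ne = ⊥-elim (ne refl)

Exactly-2 : {A : Set} {P : A → Set} → Exactly A P 2 → ∀ a b c → P a → P b → P c → a ≢ b → c ≢ a → c ≡ b
Exactly-2 (f , inj , _ , onto) a b c pa pb pc ab ca with onto a pa | onto b pb | onto c pc
... | i , fa | j , fb | k , fc with fin2-cases i j k (λ { refl → ab (trans (sym fa) fb) })
...   | inj₁ refl = ⊥-elim (ca (trans (sym fc) fa))
...   | inj₂ refl = trans (sym fc) fb

Exactly-2-other : {A : Set} {P : A → Set} → Exactly A P 2 → DecidableEquality A → (a : A) →
  Σ A λ b → P b × b ≢ a
Exactly-2-other (f , inj , pf , _) _≟_ a with f zero ≟ a
... | yes p = f (suc zero) , pf _ , λ q → 0≢1 (inj (trans p (sym q)))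
  where
  0≢1 : _≢_ {A = Fin 2} zero (suc zero)
  0≢1 ()
... | no n = f zero , pf _ , n

exactly0 : {A : Set} {P : A → Set} → (∀ a → ¬ P a) → Exactly A P 0
exactly0 np = (λ ()) , (λ {x} → λ { {()} }) , (λ ()) , λ a p → ⊥-elim (np a p)

exactly1 : {A : Set} {P : A → Set} (a : A) → P a → (∀ b → P b → a ≡ b) → Exactly A P 1
exactly1 a pa u = (λ _ → a) , (λ { {zero} {zero} _ → refl }) , (λ _ → pa) , λ b pb → zero , u b pb

exactly2 : {A : Set} {P : A → Set} (a b : A) → P a → P b → a ≢ b →
  (∀ c → P c → (c ≡ a) ⊎ (c ≡ b)) → Exactly A P 2
exactly2 {A} {P} a b pa pb ne u = f , inj , pf , onto
  where
  f : Fin 2 → A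
  f zero = a
  f (suc _) = b
  inj : ∀ {x y} → f x ≡ f y → x ≡ y
  inj {zero} {zero} _ = refl
  inj {zero} {suc zero} e = ⊥-elim (ne e)
  inj {suc zero} {zero} e = ⊥-elim (ne (sym e))
  inj {suc zero} {suc zero} _ = refl
  pf : ∀ x → P (f x)
  pf zero = pa
  pf (suc _) = pb
  onto : ∀ c → P c → ∃ λ x → f x ≡ c
  onto c pc with u c pc
  ... | inj₁ e = zero , sym e
  ... | inj₂ e = suc zero , sym e

lastOf : {A : Set} → A → List A → A
lastOf x [] = x
lastOf x (y ∷ ys) = lastOf y ys

initOf : {A : Set} → A → List A → List A
initOf x [] = []
initOf x (y ∷ ys) = x ∷ initOf y ys

init-snoc : {A : Set} (x : A) (xs : List A) → x ∷ xs ≡ initOf x xs ∷ʳ lastOf x xs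
init-snoc x [] = refl
init-snoc x (y ∷ ys) = cong (x ∷_) (init-snoc y ys)

snoc-last : {A : Set} (x : A) (xs ys : List A) (l : A) → x ∷ xs ≡ ys ∷ʳ l → lastOf x xs ≡ l
snoc-last x [] [] l refl = refl
snoc-last x [] (y ∷ []) l ()
snoc-last x [] (y ∷ z ∷ ys) l ()
snoc-last x (x' ∷ xs) [] l ()
snoc-last x (x' ∷ xs) (y ∷ ys) l eq = snoc-last x' xs ys l (cong (drop 1) eq)

linked-mid : {A : Set} {R : A → A → Set} (pre : List A) {x y : A} {rest : List A} →
  Linked R (pre ++ x ∷ y ∷ rest) → R x y
linked-mid [] (r ∷ _) = r
linked-mid (p ∷ pre) l = linked-mid pre (Linked.tail l)

linked-snoc : {A : Set} {R : A → A → Set} (pre : List A) {x z : A} →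
  Linked R (pre ++ x ∷ []) → R x z → Linked R (pre ++ x ∷ z ∷ [])
linked-snoc [] _ r = r ∷ [-]
linked-snoc (p ∷ []) (r' ∷ l) r = r' ∷ linked-snoc [] l r
linked-snoc (p ∷ q ∷ pre) (r' ∷ l) r = r' ∷ linked-snoc (q ∷ pre) l r

length-snoc : {A : Set} (pre : List A) (x z : A) → length (pre ++ x ∷ z ∷ []) ≡ suc (length (pre ++ x ∷ []))
length-snoc [] x z = refl
length-snoc (p ∷ pre) x z = cong suc (length-snoc pre x z)

∈-snoc : {A B : Set} (pre : List (A × B)) (x z : A × B) {e : A} →
  e ∈ map proj₁ (pre ++ x ∷ []) → e ∈ map proj₁ (pre ++ x ∷ z ∷ [])
∈-snoc [] x z (here p) = here p
∈-snoc (p ∷ pre) x z (here q) = here q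
∈-snoc (p ∷ pre) x z (there m) = there (∈-snoc pre x z m)

-- Directed paths, ai-walks and connections of a flow

module Paths {H K : Set} (F : Flow H K) where
  open Flow F

  data Reach : E → E → Set where
    rnil  : ∀ {e} → Reach e e
    rcons : ∀ {e e₁ e'} → Below F e e₁ → Reach e₁ e' → Reach e e'

  IntRoot : E → Set
  IntRoot e = Σ V λ v → up e ≡ inj₁ v × kind v ≡ int

  CointBot : E → Set
  CointBot e = Σ V λ v → lo e ≡ inj₁ v × kind v ≡ coint

  NoConn : Set
  NoConn = ∀ e l → IntRoot e → Reach e l → CointBot l → ⊥

  Acyclic : Set
  Acyclic = ∀ a b → Below F a b → Reach b a → ⊥

  linked⇒reach : ∀ e es → Linked (Below F) (e ∷ es) → Reach e (lastOf e es)
  linked⇒reach e [] _ = rnil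
  linked⇒reach e (x ∷ es) (b ∷ l) = rcons b (linked⇒reach x es l)

  reach⇒linked : ∀ {a b} → Reach a b → Σ (List E) λ es → Linked (Below F) (a ∷ es) × lastOf a es ≡ b
  reach⇒linked rnil = [] , [-] , refl
  reach⇒linked (rcons x r) with reach⇒linked r
  ... | es , l , eq = _ ∷ es , x ∷ l , eq

  noConn⇒noAiConnection : NoConn → NoAiConnection F
  noConn⇒noAiConnection nc es (inj₁ d) = fromDown es d
    where
    fromDown : ∀ es → ¬ DownConn F es
    fromDown (e ∷ es) (lk , ir , (l , ys , eq , cb)) =
      nc e l ir (subst (Reach e) (snoc-last e es ys l eq) (linked⇒reach e es lk)) cb
  noConn⇒noAiConnection nc es (inj₂ d) = noConn⇒noAiConnection nc (reverse es) (inj₁ d)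

  acyclic⇒noDirectedCycle : Acyclic → ∀ es → ¬ DirectedCycle F es
  acyclic⇒noDirectedCycle ac (e ∷ es) (lk , l , ys , eq , bl) =
    ac l e bl (subst (Reach e) (snoc-last e es ys l eq) (linked⇒reach e es lk))

  noDirectedCycle⇒acyclic : (∀ es → ¬ DirectedCycle F es) → Acyclic
  noDirectedCycle⇒acyclic nd a b bl r with reach⇒linked r
  ... | es , lk , eq = nd (b ∷ es) (lk , a , initOf b es , subst (λ z → b ∷ es ≡ initOf b es ∷ʳ z) eq (init-snoc b es) , bl)

  aiPath⇒linked : ∀ pre {x ys} → AiPath F (pre ++ x ∷ ys) → Linked (Link F) (pre ++ x ∷ ys)
  aiPath⇒linked [] ap = ap
  aiPath⇒linked (p ∷ pre) ap = ap

  linked⇒aiPath : ∀ pre {x ys} → Linked (Link F) (pre ++ x ∷ ys) → AiPath F (pre ++ x ∷ ys)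
  linked⇒aiPath [] lk = lk
  linked⇒aiPath (p ∷ pre) lk = lk

  vtx-just : {X : Set} (s : V ⊎ X) {v : V} → vtx F s ≡ just v → s ≡ inj₁ v
  vtx-just (inj₁ x) refl = refl
  vtx-just (inj₂ y) ()

  data Walk : E × Dir F → E × Dir F → Set where
    wone  : ∀ {x} → Walk x x
    wcons : ∀ {x y z} → Link F x y → Walk y z → Walk x z

  walk-via : ∀ {x y z w} → Walk x y → Link F y z → Walk z w → Walk x w
  walk-via wone lk w = wcons lk w
  walk-via (wcons l w) lk w' = wcons l (walk-via w lk w')

  below⇒link : ∀ {a b} → Below F a b → Link F (a , down) (b , down)
  below⇒link (v , l , u) = v , cong (vtx F) l , cong (vtx F) u , tt

  link⇒below : ∀ {a b} → Link F (a , down) (b , down) → Below F a b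
  link⇒below {a} {b} (v , t , s , _) = v , vtx-just (lo a) t , vtx-just (up b) s

  reach⇒walk : ∀ {a b} → Reach a b → Walk (a , down) (b , down)
  reach⇒walk rnil = wone
  reach⇒walk (rcons x r) = wcons (below⇒link x) (reach⇒walk r)

  IntRootDown : E × Dir F → Set
  IntRootDown (e , down) = IntRoot e
  IntRootDown (e , upw) = ⊥

  -- The last descent of a walk ending downwards at l: it starts at the
  -- beginning of the walk or right after a turn, i.e. at an interaction.
  lastDescent : ∀ {x l} → Walk x (l , down) →
    (Σ E λ a → x ≡ (a , down) × Reach a l) ⊎ (Σ E λ e' → IntRoot e' × Reach e' l)
  lastDescent wone = inj₁ (_ , refl , rnil)
  lastDescent (wcons {x} {y} lk w) with lastDescent w
  ... | inj₂ r = inj₂ r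
  lastDescent (wcons {a , down} lk w) | inj₁ (b , refl , r) = inj₁ (a , refl , rcons (link⇒below lk) r)
  lastDescent (wcons {a , upw} (v , t , s , k , _) w) | inj₁ (b , refl , r) =
    inj₂ (b , (v , vtx-just (up b) s , k) , r)

  walkFromInt⇒reach : ∀ {x l} → IntRootDown x → Walk x (l , down) → Σ E λ e' → IntRoot e' × Reach e' l
  walkFromInt⇒reach ir w with lastDescent w
  ... | inj₂ r = r
  ... | inj₁ (a , refl , r) = a , ir , r

  -- Dually, the first descent of a walk from a down to a cointeraction
  -- ends at a cointeraction.
  walkToCoint⇒reach : ∀ {a l} → Walk (a , down) (l , down) → CointBot l → Σ E λ l' → Reach a l' × CointBot l'
  walkToCoint⇒reach wone cb = _ , rnil , cb
  walkToCoint⇒reach (wcons {y = b , down} lk w) cb with walkToCoint⇒reach w cb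
  ... | l' , r , c = l' , rcons (link⇒below lk) r , c
  walkToCoint⇒reach {a} (wcons {y = b , upw} (v , t , s , k , _) w) cb = a , rnil , (v , vtx-just (lo a) t , k)

  simple← : ∀ {e} → IntRoot e → CointBot e → SimpleEdge F e
  simple← {e} ir cb = inj₁ ([-] , ir , (e , [] , refl , cb))

  simple→ : ∀ {e} → SimpleEdge F e → IntRoot e × CointBot e
  simple→ {e} (inj₁ (lk , ir , (l , ys , eq , cb))) = ir , subst CointBot (sym (snoc-last e [] ys l eq)) cb
  simple→ {e} (inj₂ (lk , ir , (l , ys , eq , cb))) = ir , subst CointBot (sym (snoc-last e [] ys l eq)) cb

  -- In a flow all of whose ai-paths are clean, every directed connection
  -- is a simple edge: the directed path is itself an ai-connection.
  cleanConnection : AllClean F → ∀ {e l} → IntRoot e → Reach e l → CointBot l → e ≡ l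
  cleanConnection clean {e} {l} ir r cb with reach⇒linked r
  ... | es , lk , eq = single es eq (proj₂ (clean (downs (e ∷ es)) (downs-linked e es lk)) [] (e ∷ es) []
          (trans (edges-downs (e ∷ es)) (sym (++-identityʳ (e ∷ es))))
          (inj₁ (lk , ir , (l , initOf e es , subst (λ z → e ∷ es ≡ initOf e es ∷ʳ z) eq (init-snoc e es) , cb))))
    where
    downs : List E → List (E × Dir F)
    downs = map (λ e → e , down)
    edges-downs : ∀ es → edges F (downs es) ≡ es
    edges-downs [] = refl
    edges-downs (e ∷ es) = cong (e ∷_) (edges-downs es)
    downs-linked : ∀ e es → Linked (Below F) (e ∷ es) → AiPath F (downs (e ∷ es))
    downs-linked e [] _ = [-]
    downs-linked e (x ∷ es) (b ∷ l) = below⇒link b ∷ downs-linked x es l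
    single : ∀ es → lastOf e es ≡ l → length (e ∷ es) ≡ 1 → e ≡ l
    single [] eq _ = eq
    single (_ ∷ _) _ ()

  -- Interface reachability, used to state the invariant of the induction:
  -- directed paths from an interaction to the lower edge j, from the upper
  -- edge i to the lower edge j, from the upper edge i to a cointeraction ...
  IntAbove : K → Set
  IntAbove j = Σ E λ e → IntRoot e × Reach e (out j)

  Through : H → K → Set
  Through i j = Reach (inp i) (out j)

  CointBelow : H → Set
  CointBelow i = Σ E λ l → Reach (inp i) l × CointBot l

  AiIntAbove : K → Set
  AiIntAbove j = Σ (E × Dir F) λ x → IntRootDown x × Walk x (out j , down)

  AiThrough : H → K → Set
  AiThrough i j = Walk (inp i , down) (out j , down)

  AiCointBelow : H → Set
  AiCointBelow i = Σ E λ l → CointBot l × Walk (inp i , down) (l , down)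

-- Embeddings of flows
--
-- Paths are mapped to paths,
-- so cycle-freeness, cleanness and acyclicity are reflected.

record Embedding {H K H' K' : Set} (F : Flow H K) (G : Flow H' K') : Set where
  private
    module F = Flow F
    module G = Flow G
  field
    φE : F.E → G.E
    φV : F.V → G.V
    up-pres : ∀ e v → F.up e ≡ inj₁ v → G.up (φE e) ≡ inj₁ (φV v)
    lo-pres : ∀ e v → F.lo e ≡ inj₁ v → G.lo (φE e) ≡ inj₁ (φV v)
    int-pres : ∀ v → F.kind v ≡ int → G.kind (φV v) ≡ int
    coint-pres : ∀ v → F.kind v ≡ coint → G.kind (φV v) ≡ coint
    φE-injective : ∀ {a b} → φE a ≡ φE b → a ≡ b

module EmbeddingFacts {H K H' K' : Set} {F : Flow H K} {G : Flow H' K'} (m : Embedding F G) where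
  open Embedding m
  private
    module F = Flow F
    module G = Flow G
    module FP = Paths F
    module GP = Paths G

  φD : Dir F → Dir G
  φD down = down
  φD upw = upw

  φx : F.E × Dir F → G.E × Dir G
  φx (e , d) = φE e , φD d

  below-pres : ∀ {a b} → Below F a b → Below G (φE a) (φE b)
  below-pres (v , l , u) = φV v , lo-pres _ v l , up-pres _ v u

  reach-pres : ∀ {a b} → FP.Reach a b → GP.Reach (φE a) (φE b)
  reach-pres FP.rnil = GP.rnil
  reach-pres (FP.rcons x r) = GP.rcons (below-pres x) (reach-pres r)

  intRoot-pres : ∀ {e} → FP.IntRoot e → GP.IntRoot (φE e)
  intRoot-pres (v , u , k) = φV v , up-pres _ v u , int-pres v k

  intRootDown-pres : ∀ x → FP.IntRootDown x → GP.IntRootDown (φx x)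
  intRootDown-pres (e , down) ir = intRoot-pres ir

  cointBot-pres : ∀ {e} → FP.CointBot e → GP.CointBot (φE e)
  cointBot-pres (v , u , k) = φV v , lo-pres _ v u , coint-pres v k

  vtx-up-pres : ∀ e v → vtx F (F.up e) ≡ just v → vtx G (G.up (φE e)) ≡ just (φV v)
  vtx-up-pres e v p rewrite up-pres e v (FP.vtx-just (F.up e) p) = refl

  vtx-lo-pres : ∀ e v → vtx F (F.lo e) ≡ just v → vtx G (G.lo (φE e)) ≡ just (φV v)
  vtx-lo-pres e v p rewrite lo-pres e v (FP.vtx-just (F.lo e) p) = refl

  tgt-pres : ∀ x v → tgt F x ≡ just v → tgt G (φx x) ≡ just (φV v)
  tgt-pres (e , down) = vtx-lo-pres e
  tgt-pres (e , upw) = vtx-up-pres e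

  src-pres : ∀ x v → src F x ≡ just v → src G (φx x) ≡ just (φV v)
  src-pres (e , down) = vtx-up-pres e
  src-pres (e , upw) = vtx-lo-pres e

  link-pres : ∀ {x y} → Link F x y → Link G (φx x) (φx y)
  link-pres {x@(_ , down)} {y@(_ , down)} (v , t , s , _) = φV v , tgt-pres x v t , src-pres y v s , tt
  link-pres {x@(_ , upw)} {y@(_ , upw)} (v , t , s , _) = φV v , tgt-pres x v t , src-pres y v s , tt
  link-pres {x@(_ , upw)} {y@(_ , down)} (v , t , s , k , ne) =
    φV v , tgt-pres x v t , src-pres y v s , int-pres v k , λ q → ne (φE-injective q)
  link-pres {x@(_ , down)} {y@(_ , upw)} (v , t , s , k , ne) =
    φV v , tgt-pres x v t , src-pres y v s , coint-pres v k , λ q → ne (φE-injective q)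

  linked-pres : ∀ {xs} → Linked (Link F) xs → Linked (Link G) (map φx xs)
  linked-pres ls = LinkedP.map⁺ (Linked.map link-pres ls)

  aiPath-pres : ∀ w → AiPath F w → AiPath G (map φx w)
  aiPath-pres (x ∷ w) p = linked-pres p

  edges-map : ∀ w → edges G (map φx w) ≡ map φE (edges F w)
  edges-map [] = refl
  edges-map (x ∷ w) = cong (φE (proj₁ x) ∷_) (edges-map w)

  walk-pres : ∀ {x y} → FP.Walk x y → GP.Walk (φx x) (φx y)
  walk-pres FP.wone = GP.wone
  walk-pres (FP.wcons l w) = GP.wcons (link-pres l) (walk-pres w)

  downConn-pres : ∀ es → DownConn F es → DownConn G (map φE es)
  downConn-pres (e ∷ es) (lk , (ν , u , k) , (l , ys , eq , μ , l' , k')) =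
    LinkedP.map⁺ (Linked.map below-pres lk) , (φV ν , up-pres _ ν u , int-pres ν k) ,
    (φE l , map φE ys , trans (cong (map φE) eq) (map-++ φE ys (l ∷ [])) , φV μ , lo-pres _ μ l' , coint-pres μ k')

  aiConnection-pres : ∀ es → AiConnection F es → AiConnection G (map φE es)
  aiConnection-pres es (inj₁ d) = inj₁ (downConn-pres es d)
  aiConnection-pres es (inj₂ d) = inj₂ (subst (DownConn G) (reverse-map φE es) (downConn-pres (reverse es) d))

  -- every ai-connection inside an ai-path of F maps to one inside its image
  allClean-refl : AllClean G → AllClean F
  allClean-refl clean w ap = ap , λ xs s ys eq c →
    trans (sym (length-map φE s))
      (proj₂ (clean (map φx w) (aiPath-pres w ap)) (map φE xs) (map φE s) (map φE ys)
        (trans (edges-map w) (trans (cong (map φE) eq) (trans (map-++ φE xs (s ++ ys)) (cong (map φE xs ++_) (map-++ φE s ys)))))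
        (aiConnection-pres s c))

  acyclic-refl : GP.Acyclic → FP.Acyclic
  acyclic-refl ac a b bl r = ac (φE a) (φE b) (below-pres bl) (reach-pres r)

  cycleFree-refl : CycleFree G → CycleFree F
  cycleFree-refl cf w (ap , u , v , s , e) =
    cf (map φx w) (aiPath-pres w ap , subst Unique (sym (edges-map w)) (Unique.map⁺ φE-injective u) ,
                   φV v , starts w s , ends e)
    where
    starts : ∀ w → StartsAt F v w → StartsAt G (φV v) (map φx w)
    starts (x ∷ w) p = src-pres x v p
    ends : EndsAt F v w → EndsAt G (φV v) (map φx w)
    ends (ys , x , eq , t) = map φx ys , φx x , trans (cong (map φx) eq) (map-++ φx ys (x ∷ [])) , tgt-pres x v t

-- The flows B' and B''

module SplitFacts {H K : Set} (B : Flow H K) (r : Redex B) (isF : IsFlow B) where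
  open Flow B
  open Redex r
  open Split B r
  open IsFlow isF

  noUpper-ν : ∀ e → lo e ≢ inj₁ ν
  noUpper-ν = Exactly-0 (subst (Exactly E (λ e → lo e ≡ inj₁ ν)) (cong nUp νint) (upperDeg ν))

  noLower-μ : ∀ e → up e ≢ inj₁ μ
  noLower-μ = Exactly-0 (subst (Exactly E (λ e → up e ≡ inj₁ μ)) (cong nLow μco) (lowerDeg μ))

  lower-ν : ∀ e → up e ≡ inj₁ ν → e ≢ ε₁ → e ≡ ε₂
  lower-ν e p ne = Exactly-2 (subst (Exactly E (λ e → up e ≡ inj₁ ν)) (cong nLow νint) (lowerDeg ν))
    ε₁ ε₂ e ε₁up ε₂up p (λ q → ε₂≢ (sym q)) ne

  upper-μ : ∀ e → lo e ≡ inj₁ μ → e ≢ ε₁ → e ≡ ε₃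
  upper-μ e p ne = Exactly-2 (subst (Exactly E (λ e → lo e ≡ inj₁ μ)) (cong nUp μco) (upperDeg μ))
    ε₁ ε₃ e ε₁lo ε₃lo p (λ q → ε₃≢ (sym q)) ne

  gone⇒νμ : ∀ v → gone v ≡ true → (v ≡ ν) ⊎ (v ≡ μ)
  gone⇒νμ v g with decV v ν
  ... | yes p = inj₁ p
  ... | no _ with decV v μ
  ...   | yes p = inj₂ p
  gone⇒νμ v () | no _ | no _

  kept⇒≢ν : ∀ {v} → T (not (gone v)) → v ≢ ν
  kept⇒≢ν t refl rewrite goneν = t

  kept⇒≢μ : ∀ {v} → T (not (gone v)) → v ≢ μ
  kept⇒≢μ t refl rewrite goneμ = t

  goneUp : ∀ e v → up e ≡ inj₁ v → gone v ≡ true → v ≡ ν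
  goneUp e v p g with gone⇒νμ v g
  ... | inj₁ q = q
  ... | inj₂ refl = ⊥-elim (noLower-μ e p)

  goneLo : ∀ e v → lo e ≡ inj₁ v → gone v ≡ true → v ≡ μ
  goneLo e v p g with gone⇒νμ v g
  ... | inj₂ q = q
  ... | inj₁ refl = ⊥-elim (noUpper-ν e p)

  classify-kept : ∀ v a → classify v ≡ inj₁ a → proj₁ a ≡ v
  classify-kept v a = go (gone v) refl
    where
    go : ∀ b (eq : b ≡ gone v) → cl v b eq ≡ inj₁ a → proj₁ a ≡ v
    go false eq refl = refl

  classify-gone⁻¹ : ∀ v → classify v ≡ inj₂ tt → gone v ≡ true
  classify-gone⁻¹ v = go (gone v) refl
    where
    go : ∀ b (eq : b ≡ gone v) → cl v b eq ≡ inj₂ tt → gone v ≡ true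
    go true eq _ = sym eq

  classify-survivor : ∀ v (t : T (not (gone v))) → classify v ≡ inj₁ (v , t)
  classify-survivor v t = go (gone v) refl
    where
    go : ∀ b (eq : b ≡ gone v) → cl v b eq ≡ inj₁ (v , t)
    go false eq = cong inj₁ (Keep-≡ refl)
    go true eq = ⊥-elim (subst (λ b → T (not b)) (sym eq) t)

  keptEdge≢ε₁ : ∀ (e : EA) → proj₁ e ≢ ε₁
  keptEdge≢ε₁ (e , t) refl with decE e e
  ... | yes _ = t
  ... | no n = n refl

  toEA : E → EA
  toEA e with decE e ε₁
  ... | yes _ = mkE ε₂ ε₂≢
  ... | no ne = mkE e ne

  toEA-ok : ∀ e → e ≢ ε₁ → proj₁ (toEA e) ≡ e
  toEA-ok e ne with decE e ε₁
  ... | yes p = ⊥-elim (ne p)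
  ... | no _ = refl

  upSurvivor⇒≢ε₁ : ∀ a v → up a ≡ inj₁ v → T (not (gone v)) → a ≢ ε₁
  upSurvivor⇒≢ε₁ a v p t refl = kept⇒≢ν t (inj₁-injective (trans (sym p) ε₁up))

  loSurvivor⇒≢ε₁ : ∀ a v → lo a ≡ inj₁ v → T (not (gone v)) → a ≢ ε₁
  loSurvivor⇒≢ε₁ a v p t refl = kept⇒≢μ t (inj₁-injective (trans (sym p) ε₁lo))

  -- All four end maps of B' and B'' have the same shape: a surviving
  -- vertex is kept, a removed vertex is sent to  w  and a dangling end to  f.
  relocate : {X Y : Set} → (VA ⊎ ⊤) ⊎ Y → (X → (VA ⊎ ⊤) ⊎ Y) → V ⊎ X → (VA ⊎ ⊤) ⊎ Y
  relocate w f = [ (λ v → [ (λ a → inj₁ (inj₁ a)) , (λ _ → w) ]′ (classify v)) , f ]′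

  module _ {X Y : Set} {w : (VA ⊎ ⊤) ⊎ Y} {f : X → (VA ⊎ ⊤) ⊎ Y} where

    relocate-survivor : (s : V ⊎ X) (v : V) → s ≡ inj₁ v → (t : T (not (gone v))) →
      relocate w f s ≡ inj₁ (inj₁ (v , t))
    relocate-survivor .(inj₁ v) v refl t rewrite classify-survivor v t = refl

    relocate-gone : (s : V ⊎ X) (v : V) → s ≡ inj₁ v → gone v ≡ true → relocate w f s ≡ w
    relocate-gone .(inj₁ v) v refl g rewrite classify-gone v g = refl

    relocate⁻¹-survivor : (s : V ⊎ X) (a : VA) → relocate w f s ≡ inj₁ (inj₁ a) →
      (∀ x → f x ≢ inj₁ (inj₁ a)) → w ≢ inj₁ (inj₁ a) → s ≡ inj₁ (proj₁ a)
    relocate⁻¹-survivor (inj₂ x) a p nf nw = ⊥-elim (nf x p)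
    relocate⁻¹-survivor (inj₁ v) a p nf nw with classify v in eq
    ... | inj₁ a' with p
    ...   | refl = cong inj₁ (sym (classify-kept v a' eq))
    relocate⁻¹-survivor (inj₁ v) a p nf nw | inj₂ _ = ⊥-elim (nw p)

    relocate⁻¹-gone : (s : V ⊎ X) → relocate w f s ≡ w → (∀ x → f x ≢ w) → (∀ a → inj₁ (inj₁ a) ≢ w) →
      Σ V λ v → s ≡ inj₁ v × gone v ≡ true
    relocate⁻¹-gone (inj₂ x) p nf na = ⊥-elim (nf x p)
    relocate⁻¹-gone (inj₁ v) p nf na with classify v in eq
    ... | inj₁ a = ⊥-elim (na a p)
    ... | inj₂ tt = v , refl , classify-gone⁻¹ v eq

    relocate⁻¹-dangling : (s : V ⊎ X) (x : X) → relocate w f s ≡ f x → (∀ {x y} → f x ≡ f y → x ≡ y) →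
      w ≢ f x → (∀ a → inj₁ (inj₁ a) ≢ f x) → s ≡ inj₂ x
    relocate⁻¹-dangling (inj₂ y) x p f-inj nw na = cong inj₂ (f-inj p)
    relocate⁻¹-dangling (inj₁ v) x p f-inj nw na with classify v
    ... | inj₁ a = ⊥-elim (na a p)
    ... | inj₂ tt = ⊥-elim (nw p)

    relocate-avoids : (s : V ⊎ X) (z : (VA ⊎ ⊤) ⊎ Y) → relocate w f s ≡ z →
      w ≢ z → (∀ x → f x ≢ z) → (∀ a → inj₁ (inj₁ a) ≢ z) → ⊥
    relocate-avoids (inj₂ x) z p nw nf na = nf x p
    relocate-avoids (inj₁ v) z p nw nf na with classify v
    ... | inj₁ a = na a p
    ... | inj₂ tt = nw p

  up'-kept : ∀ e a → up' e ≡ inj₁ (inj₁ a) → up (proj₁ e) ≡ inj₁ (proj₁ a)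
  up'-kept e a p = relocate⁻¹-survivor (up (proj₁ e)) a p (λ _ ()) (λ ())

  up'-weakening : ∀ e → up' e ≡ inj₁ (inj₂ tt) → proj₁ e ≡ ε₂
  up'-weakening e p with relocate⁻¹-gone (up (proj₁ e)) p (λ _ ()) (λ _ ())
  ... | v , q , g = lower-ν (proj₁ e) (subst (λ z → up (proj₁ e) ≡ inj₁ z) (goneUp (proj₁ e) v q g) q) (keptEdge≢ε₁ e)

  up'-dangling : ∀ e i → up' e ≡ inj₂ i → up (proj₁ e) ≡ inj₂ i
  up'-dangling e i p = relocate⁻¹-dangling (up (proj₁ e)) i p (λ { refl → refl }) (λ ()) (λ _ ())

  lo'-kept : ∀ e a → lo' e ≡ inj₁ (inj₁ a) → lo (proj₁ e) ≡ inj₁ (proj₁ a)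
  lo'-kept e a p = relocate⁻¹-survivor (lo (proj₁ e)) a p (λ _ ()) (λ ())

  lo'-notWeakening : ∀ e → lo' e ≢ inj₁ (inj₂ tt)
  lo'-notWeakening e p = relocate-avoids (lo (proj₁ e)) _ p (λ ()) (λ _ ()) (λ _ ())

  lo'-new : ∀ e → lo' e ≡ inj₂ (inj₂ tt) → proj₁ e ≡ ε₃
  lo'-new e p with relocate⁻¹-gone (lo (proj₁ e)) p (λ _ ()) (λ _ ())
  ... | v , q , g = upper-μ (proj₁ e) (subst (λ z → lo (proj₁ e) ≡ inj₁ z) (goneLo (proj₁ e) v q g) q) (keptEdge≢ε₁ e)

  lo'-dangling : ∀ e j → lo' e ≡ inj₂ (inj₁ j) → lo (proj₁ e) ≡ inj₂ j
  lo'-dangling e j p = relocate⁻¹-dangling (lo (proj₁ e)) j p (λ { refl → refl }) (λ ()) (λ _ ())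

  up''-kept : ∀ e a → up'' e ≡ inj₁ (inj₁ a) → up (proj₁ e) ≡ inj₁ (proj₁ a)
  up''-kept e a p = relocate⁻¹-survivor (up (proj₁ e)) a p (λ _ ()) (λ ())

  up''-notCoweakening : ∀ e → up'' e ≢ inj₁ (inj₂ tt)
  up''-notCoweakening e p = relocate-avoids (up (proj₁ e)) _ p (λ ()) (λ _ ()) (λ _ ())

  up''-new : ∀ e → up'' e ≡ inj₂ (inj₂ tt) → proj₁ e ≡ ε₂
  up''-new e p with relocate⁻¹-gone (up (proj₁ e)) p (λ _ ()) (λ _ ())
  ... | v , q , g = lower-ν (proj₁ e) (subst (λ z → up (proj₁ e) ≡ inj₁ z) (goneUp (proj₁ e) v q g) q) (keptEdge≢ε₁ e)

  up''-dangling : ∀ e i → up'' e ≡ inj₂ (inj₁ i) → up (proj₁ e) ≡ inj₂ i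
  up''-dangling e i p = relocate⁻¹-dangling (up (proj₁ e)) i p (λ { refl → refl }) (λ ()) (λ _ ())

  lo''-kept : ∀ e a → lo'' e ≡ inj₁ (inj₁ a) → lo (proj₁ e) ≡ inj₁ (proj₁ a)
  lo''-kept e a p = relocate⁻¹-survivor (lo (proj₁ e)) a p (λ _ ()) (λ ())

  lo''-coweakening : ∀ e → lo'' e ≡ inj₁ (inj₂ tt) → proj₁ e ≡ ε₃
  lo''-coweakening e p with relocate⁻¹-gone (lo (proj₁ e)) p (λ _ ()) (λ _ ())
  ... | v , q , g = upper-μ (proj₁ e) (subst (λ z → lo (proj₁ e) ≡ inj₁ z) (goneLo (proj₁ e) v q g) q) (keptEdge≢ε₁ e)

  lo''-dangling : ∀ e j → lo'' e ≡ inj₂ j → lo (proj₁ e) ≡ inj₂ j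
  lo''-dangling e j p = relocate⁻¹-dangling (lo (proj₁ e)) j p (λ { refl → refl }) (λ ()) (λ _ ())

  embed' : Embedding B' B
  embed' = record
    { φE = proj₁ ; φV = [ proj₁ , (λ _ → ν) ]′
    ; up-pres = λ { e (inj₁ a) p → up'-kept e a p ; e (inj₂ tt) p → trans (cong up (up'-weakening e p)) ε₂up }
    ; lo-pres = λ { e (inj₁ a) p → lo'-kept e a p ; e (inj₂ tt) p → ⊥-elim (lo'-notWeakening e p) }
    ; int-pres = λ { (inj₁ a) k → k ; (inj₂ tt) () }
    ; coint-pres = λ { (inj₁ a) k → k ; (inj₂ tt) () }
    ; φE-injective = Keep-≡ }

  embed'' : Embedding B'' B
  embed'' = record
    { φE = proj₁ ; φV = [ proj₁ , (λ _ → μ) ]′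
    ; up-pres = λ { e (inj₁ a) p → up''-kept e a p ; e (inj₂ tt) p → ⊥-elim (up''-notCoweakening e p) }
    ; lo-pres = λ { e (inj₁ a) p → lo''-kept e a p ; e (inj₂ tt) p → trans (cong lo (lo''-coweakening e p)) ε₃lo }
    ; int-pres = λ { (inj₁ a) k → k ; (inj₂ tt) () }
    ; coint-pres = λ { (inj₁ a) k → k ; (inj₂ tt) () }
    ; φE-injective = Keep-≡ }

  finite-VA : Finite (VA ⊎ ⊤)
  finite-VA = listable⇒finite (Sum.≡-dec (decEq-Keep _ decV) ⊤._≟_)
                (listable-⊎ (listable-Keep _ (finite⇒listable finV)) listable-⊤)

  finite-EA : Finite EA
  finite-EA = listable⇒finite (decEq-Keep _ decE) (listable-Keep _ (finite⇒listable finE))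

  degree-survivor : {X Y : Set} (S : E → V ⊎ X) (w : (VA ⊎ ⊤) ⊎ Y) (f : X → (VA ⊎ ⊤) ⊎ Y) →
    (∀ a v → S a ≡ inj₁ v → T (not (gone v)) → a ≢ ε₁) →
    (∀ a x → f x ≢ inj₁ (inj₁ a)) → (∀ a → w ≢ inj₁ (inj₁ a)) →
    ∀ v t n → Exactly E (λ e → S e ≡ inj₁ v) n →
    Exactly EA (λ e → relocate w f (S (proj₁ e)) ≡ inj₁ (inj₁ (v , t))) n
  degree-survivor S w f ≢ε₁ nf nw v t n ex = Exactly-push ex toEA
    (λ a p → relocate-survivor (S (proj₁ (toEA a))) v (trans (cong S (toEA-ok a (≢ε₁ a v p t))) p) t)
    (λ a a' p p' q → trans (sym (toEA-ok a (≢ε₁ a v p t))) (trans (cong proj₁ q) (toEA-ok a' (≢ε₁ a' v p' t))))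
    (λ b q → proj₁ b , relocate⁻¹-survivor (S (proj₁ b)) (v , t) q (nf (v , t)) (nw (v , t)) ,
             Keep-≡ (toEA-ok (proj₁ b) (keptEdge≢ε₁ b)))


  isFlow' : IsFlow B'
  isFlow' = record
    { finV = finite-VA ; finE = finite-EA
    ; inpUniq = λ e i p → Keep-≡ (inpUniq (proj₁ e) i (up'-dangling e i p))
    ; outUniq = λ { e (inj₁ j) p → Keep-≡ (outUniq (proj₁ e) j (lo'-dangling e j p))
                  ; e (inj₂ tt) p → Keep-≡ (lo'-new e p) }
    ; upperDeg = λ { (inj₁ (v , t)) → degree-survivor lo (inj₂ (inj₂ tt)) (inj₂ ∘ inj₁) loSurvivor⇒≢ε₁ (λ _ _ ()) (λ _ ()) v t _ (upperDeg v)
                   ; (inj₂ tt) → exactly0 lo'-notWeakening }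
    ; lowerDeg = λ { (inj₁ (v , t)) → degree-survivor up (inj₁ (inj₂ tt)) inj₂ upSurvivor⇒≢ε₁ (λ _ _ ()) (λ _ ()) v t _ (lowerDeg v)
                   ; (inj₂ tt) → exactly1 (mkE ε₂ ε₂≢) (relocate-gone (up ε₂) ν ε₂up goneν)
                                          (λ b p → Keep-≡ (sym (up'-weakening b p))) }
    ; acyclic = P'.acyclic⇒noDirectedCycle (EmbeddingFacts.acyclic-refl embed' (PB.noDirectedCycle⇒acyclic acyclic))
    ; polCtr = λ { (inj₁ a) k e e' ie ie' → polCtr (proj₁ a) k (proj₁ e) (proj₁ e') (inc {e} {a} ie) (inc {e'} {a} ie')
                 ; (inj₂ tt) (inj₁ ()) ; (inj₂ tt) (inj₂ ()) }
    ; polInt = λ { (inj₁ a) k e e' ie ie' ne →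
                     polInt (proj₁ a) k (proj₁ e) (proj₁ e') (inc {e} {a} ie) (inc {e'} {a} ie') (λ q → ne (Keep-≡ q))
                 ; (inj₂ tt) (inj₁ ()) ; (inj₂ tt) (inj₂ ()) }
    }
    where
    module P' = Paths B'
    module PB = Paths B
    inc : ∀ {e a} → Incident B' e (inj₁ a) → Incident B (proj₁ e) (proj₁ a)
    inc {e} {a} (inj₁ p) = inj₁ (up'-kept e a p)
    inc {e} {a} (inj₂ p) = inj₂ (lo'-kept e a p)

  isFlow'' : IsFlow B''
  isFlow'' = record
    { finV = finite-VA ; finE = finite-EA
    ; inpUniq = λ { e (inj₁ i) p → Keep-≡ (inpUniq (proj₁ e) i (up''-dangling e i p))
                  ; e (inj₂ tt) p → Keep-≡ (up''-new e p) }
    ; outUniq = λ e j p → Keep-≡ (outUniq (proj₁ e) j (lo''-dangling e j p))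
    ; upperDeg = λ { (inj₁ (v , t)) → degree-survivor lo (inj₁ (inj₂ tt)) inj₂ loSurvivor⇒≢ε₁ (λ _ _ ()) (λ _ ()) v t _ (upperDeg v)
                   ; (inj₂ tt) → exactly1 (mkE ε₃ ε₃≢) (relocate-gone (lo ε₃) μ ε₃lo goneμ)
                                          (λ b p → Keep-≡ (sym (lo''-coweakening b p))) }
    ; lowerDeg = λ { (inj₁ (v , t)) → degree-survivor up (inj₂ (inj₂ tt)) (inj₂ ∘ inj₁) upSurvivor⇒≢ε₁ (λ _ _ ()) (λ _ ()) v t _ (lowerDeg v)
                   ; (inj₂ tt) → exactly0 up''-notCoweakening }
    ; acyclic = P''.acyclic⇒noDirectedCycle (EmbeddingFacts.acyclic-refl embed'' (PB.noDirectedCycle⇒acyclic acyclic))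
    ; polCtr = λ { (inj₁ a) k e e' ie ie' → polCtr (proj₁ a) k (proj₁ e) (proj₁ e') (inc {e} {a} ie) (inc {e'} {a} ie')
                 ; (inj₂ tt) (inj₁ ()) ; (inj₂ tt) (inj₂ ()) }
    ; polInt = λ { (inj₁ a) k e e' ie ie' ne →
                     polInt (proj₁ a) k (proj₁ e) (proj₁ e') (inc {e} {a} ie) (inc {e'} {a} ie') (λ q → ne (Keep-≡ q))
                 ; (inj₂ tt) (inj₁ ()) ; (inj₂ tt) (inj₂ ()) }
    }
    where
    module P'' = Paths B''
    module PB = Paths B
    inc : ∀ {e a} → Incident B'' e (inj₁ a) → Incident B (proj₁ e) (proj₁ a)
    inc {e} {a} (inj₁ p) = inj₁ (up''-kept e a p)
    inc {e} {a} (inj₂ p) = inj₂ (lo''-kept e a p)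

  open Paths B using (aiPath⇒linked; linked⇒aiPath) renaming (vtx-just to vj)

  next : Dir B → E × Dir B
  next down = ε₃ , upw
  next upw = ε₂ , down

  link-next : ∀ d → Link B (ε₁ , d) (next d)
  link-next down = μ , cong (vtx B) ε₁lo , cong (vtx B) ε₃lo , μco , λ q → ε₃≢ (sym q)
  link-next upw = ν , cong (vtx B) ε₁up , cong (vtx B) ε₂up , νint , λ q → ε₂≢ (sym q)

  link-from-ε₁ : ∀ {d z} → Link B (ε₁ , d) z → proj₁ z ≡ proj₁ (next d)
  link-from-ε₁ {down} {e , down} (v , t , s , _) =
    ⊥-elim (noLower-μ e (trans (vj (up e) s) (cong inj₁ (inj₁-injective (trans (sym (vj (lo ε₁) t)) ε₁lo)))))
  link-from-ε₁ {down} {e , upw} (v , t , s , _ , ne) =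
    upper-μ e (trans (vj (lo e) s) (cong inj₁ (inj₁-injective (trans (sym (vj (lo ε₁) t)) ε₁lo)))) (λ q → ne (sym q))
  link-from-ε₁ {upw} {e , down} (v , t , s , _ , ne) =
    lower-ν e (trans (vj (up e) s) (cong inj₁ (inj₁-injective (trans (sym (vj (up ε₁) t)) ε₁up)))) (λ q → ne (sym q))
  link-from-ε₁ {upw} {e , upw} (v , t , s , _) =
    ⊥-elim (noUpper-ν e (trans (vj (lo e) s) (cong inj₁ (inj₁-injective (trans (sym (vj (up ε₁) t)) ε₁up)))))

  -- Hence on a maximal clean path ε₁ is followed by ε₂ or ε₃; if ε₁ is
  -- extremal, that edge is not simple.
  extremal⇒notBothSimple : Extremal B ε₁ → SimpleEdge B ε₂ → SimpleEdge B ε₃ → ⊥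
  extremal⇒notBothSimple (_ , pre , d , [] , (ap , maximal) , _) _ _ =
    1+n≰n (subst (_≤ length (pre ++ (ε₁ , d) ∷ [])) (length-snoc pre (ε₁ , d) (next d))
            (maximal _ (linked⇒aiPath pre (linked-snoc pre (aiPath⇒linked pre ap) (link-next d))) (∈-snoc pre (ε₁ , d) (next d))))
  extremal⇒notBothSimple (_ , pre , d , z ∷ post , (ap , _) , _ , notSimple ∷ _) s₂ s₃ =
    notSimple (subst (SimpleEdge B) (sym (link-from-ε₁ (linked-mid pre (aiPath⇒linked pre ap)))) (simple d))
    where
    simple : ∀ d → SimpleEdge B (proj₁ (next d))
    simple down = s₃
    simple upw = s₂

  -- ε₁ is counted by any list enumerating E, but not by its image in EA.
  dropε₁ : List E → List EA
  dropε₁ [] = []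
  dropε₁ (x ∷ xs) with decE x ε₁
  ... | yes _ = dropε₁ xs
  ... | no ne = mkE x ne ∷ dropε₁ xs

  dropε₁-∈ : ∀ xs (a : EA) → proj₁ a ∈ xs → a ∈ dropε₁ xs
  dropε₁-∈ (x ∷ xs) a (here p) with decE x ε₁
  ... | yes q = ⊥-elim (keptEdge≢ε₁ a (trans p q))
  ... | no ne = here (Keep-≡ p)
  dropε₁-∈ (x ∷ xs) a (there m) with decE x ε₁
  ... | yes q = dropε₁-∈ xs a m
  ... | no ne = there (dropε₁-∈ xs a m)

  dropε₁-≤ : ∀ xs → length (dropε₁ xs) ≤ length xs
  dropε₁-≤ [] = z≤n
  dropε₁-≤ (x ∷ xs) with decE x ε₁
  ... | yes _ = m≤n⇒m≤1+n (dropε₁-≤ xs)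
  ... | no _ = s≤s (dropε₁-≤ xs)

  dropε₁-< : ∀ xs → ε₁ ∈ xs → length (dropε₁ xs) < length xs
  dropε₁-< (x ∷ xs) (here p) with decE x ε₁
  ... | yes _ = s≤s (dropε₁-≤ xs)
  ... | no ne = ⊥-elim (ne (sym p))
  dropε₁-< (x ∷ xs) (there m) with decE x ε₁
  ... | yes _ = m≤n⇒m≤1+n (dropε₁-< xs m)
  ... | no _ = s≤s (dropε₁-< xs m)

  -- ε₂ and ε₃ carry the same polarity, both being opposite to that of ε₁;
  -- so the two copies can be identified in Comb(D', D'').
  pol-ε₂≡ε₃ : pol ε₂ ≡ pol ε₃
  pol-ε₂≡ε₃ = opposites (pol ε₁) (pol ε₂) (pol ε₃)
    (polInt ν (inj₁ νint) ε₁ ε₂ (inj₁ ε₁up) (inj₁ ε₂up) (λ q → ε₂≢ (sym q)))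
    (polInt μ (inj₂ μco) ε₁ ε₃ (inj₂ ε₁lo) (inj₂ ε₃lo) (λ q → ε₃≢ (sym q)))
    where
    opposites : ∀ a b c → a ≢ b → a ≢ c → b ≡ c
    opposites pos pos _ n _ = ⊥-elim (n refl)
    opposites pos neg pos _ n = ⊥-elim (n refl)
    opposites pos neg neg _ _ = refl
    opposites neg pos pos _ _ = refl
    opposites neg pos neg _ n = ⊥-elim (n refl)
    opposites neg neg _ n _ = ⊥-elim (n refl)

-- The flow Comb(D', D'')
--
-- Comb(D', D'') is a flow when D' and D'' are flows whose interface
-- polarities agree; its directed paths decompose into directed paths of
-- D' and D'', crossing from D' to D'' only through ε̃₃ = ε̂₂.

module CombFacts {H K : Set} (D' : Flow H (K ⊎ ⊤)) (D'' : Flow (H ⊎ ⊤) K)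
  (isP : IsFlow D') (isQ : IsFlow D'') where
  open CombM D' D'' hiding (Comb)
  module PI = IsFlow isP
  module QI = IsFlow isQ
  module PP = Paths D'
  module QP = Paths D''
  C : Flow H K
  C = Comb D' D''
  module CP = Paths C

  ε̃₃ : P.E
  ε̃₃ = P.out (inj₂ tt)

  ε̂₂ : Q.E
  ε̂₂ = Q.inp (inj₂ tt)

  -- the lower end in D'' of ε̂₂, which becomes the lower end of ε̃₃
  slotLo : Q.V ⊎ K
  slotLo = Q.lo ε̂₂

  pV : P.V → CV
  pV v = inj₁ v
  qV : Q.V → CV
  qV w = inj₂ (inj₁ w)
  cV : H → CV
  cV i = inj₂ (inj₂ (inj₁ i))
  tV : K → CV
  tV j = inj₂ (inj₂ (inj₂ j))

  KQ : Set
  KQ = Keep Q.E (λ e → not (isSlot (Q.up e)))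

  qE : KQ → CE
  qE k = inj₂ (inj₁ k)
  hE : H → CE
  hE i = inj₂ (inj₂ (inj₁ i))
  kE : K → CE
  kE j = inj₂ (inj₂ (inj₂ j))

  -- Suffixes name the kind of
  -- target: -p a vertex of D', -q a vertex of D'', -c a new cocontraction,
  -- -t a new contraction, -2 an upper edge position of C.  cupP is the
  -- upper end in C of an edge of D'.
  cupP : P.V ⊎ H → CV ⊎ H
  cupP = [ (λ v → inj₁ (inj₁ v)) , (λ i → inj₁ (inj₂ (inj₂ (inj₁ i)))) ]′

  cupP-p : ∀ s v → cupP s ≡ inj₁ (pV v) → s ≡ inj₁ v
  cupP-p (inj₁ x) v refl = refl
  cupP-p (inj₂ y) v ()
  cupP-c : ∀ s i → cupP s ≡ inj₁ (cV i) → s ≡ inj₂ i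
  cupP-c (inj₁ x) i ()
  cupP-c (inj₂ y) i refl = refl
  cupP-q : ∀ s w → cupP s ≢ inj₁ (qV w)
  cupP-q (inj₁ x) w ()
  cupP-q (inj₂ y) w ()
  cupP-t : ∀ s j → cupP s ≢ inj₁ (tV j)
  cupP-t (inj₁ x) j ()
  cupP-t (inj₂ y) j ()
  cupP-2 : ∀ s i → cupP s ≢ inj₂ i
  cupP-2 (inj₁ x) i ()
  cupP-2 (inj₂ y) i ()

  upQ-q : ∀ s t w → upQ s t ≡ inj₁ (qV w) → s ≡ inj₁ w
  upQ-q (inj₁ x) t w refl = refl
  upQ-q (inj₂ (inj₁ x)) t w ()
  upQ-q (inj₂ (inj₂ y)) () w p
  upQ-c : ∀ s t i → upQ s t ≡ inj₁ (cV i) → s ≡ inj₂ (inj₁ i)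
  upQ-c (inj₁ x) t i ()
  upQ-c (inj₂ (inj₁ x)) t i refl = refl
  upQ-c (inj₂ (inj₂ y)) () i p
  upQ-p : ∀ s t v → upQ s t ≢ inj₁ (pV v)
  upQ-p (inj₁ x) t v ()
  upQ-p (inj₂ (inj₁ x)) t v ()
  upQ-p (inj₂ (inj₂ y)) () v p
  upQ-t : ∀ s t j → upQ s t ≢ inj₁ (tV j)
  upQ-t (inj₁ x) t j ()
  upQ-t (inj₂ (inj₁ x)) t j ()
  upQ-t (inj₂ (inj₂ y)) () j p
  upQ-2 : ∀ s t i → upQ s t ≢ inj₂ i
  upQ-2 (inj₁ x) t i ()
  upQ-2 (inj₂ (inj₁ x)) t i ()
  upQ-2 (inj₂ (inj₂ y)) () i p

  loQ-q : ∀ s w → loQ s ≡ qV w → s ≡ inj₁ w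
  loQ-q (inj₁ x) w refl = refl
  loQ-q (inj₂ y) w ()
  loQ-t : ∀ s j → loQ s ≡ tV j → s ≡ inj₂ j
  loQ-t (inj₁ x) j ()
  loQ-t (inj₂ y) j refl = refl
  loQ-p : ∀ s v → loQ s ≢ pV v
  loQ-p (inj₁ x) v ()
  loQ-p (inj₂ y) v ()
  loQ-c : ∀ s i → loQ s ≢ cV i
  loQ-c (inj₁ x) i ()
  loQ-c (inj₂ y) i ()

  loP-p : ∀ s v → loP s ≡ pV v → s ≡ inj₁ v
  loP-p (inj₁ x) v refl = refl
  loP-p (inj₂ (inj₁ x)) v ()
  loP-p (inj₂ (inj₂ tt)) v p = ⊥-elim (loQ-p slotLo v p)
  loP-q : ∀ s w → loP s ≡ qV w → (s ≡ inj₂ (inj₂ tt)) × (slotLo ≡ inj₁ w)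
  loP-q (inj₁ x) w ()
  loP-q (inj₂ (inj₁ x)) w ()
  loP-q (inj₂ (inj₂ tt)) w p = refl , loQ-q slotLo w p
  loP-t : ∀ s j → loP s ≡ tV j → (s ≡ inj₂ (inj₁ j)) ⊎ ((s ≡ inj₂ (inj₂ tt)) × (slotLo ≡ inj₂ j))
  loP-t (inj₁ x) j ()
  loP-t (inj₂ (inj₁ x)) j refl = inj₁ refl
  loP-t (inj₂ (inj₂ tt)) j p = inj₂ (refl , loQ-t slotLo j p)
  loP-c : ∀ s i → loP s ≢ cV i
  loP-c (inj₁ x) i ()
  loP-c (inj₂ (inj₁ x)) i ()
  loP-c (inj₂ (inj₂ tt)) i p = loQ-c slotLo i p

  isSlot-inv : ∀ s → isSlot s ≡ true → s ≡ inj₂ (inj₂ tt)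
  isSlot-inv (inj₁ x) ()
  isSlot-inv (inj₂ (inj₁ x)) ()
  isSlot-inv (inj₂ (inj₂ tt)) _ = refl

  keptNotSlot : ∀ (k : KQ) → proj₁ k ≢ ε̂₂
  keptNotSlot (e , t) refl rewrite Q.inpUp (inj₂ tt) = t

  slotEdge : ∀ e → isSlot (Q.up e) ≡ true → e ≡ ε̂₂
  slotEdge e p = QI.inpUniq e (inj₂ tt) (isSlot-inv (Q.up e) p)

  mkKQ : ∀ e → isSlot (Q.up e) ≡ false → KQ
  mkKQ e p = e , subst (λ b → T (not b)) (sym p) tt

  -- C is finite: H and K are listable, each i (j) being the upper (lower)
  -- end of an edge of D' (D'').
  listable-H : Listable H
  listable-H = listable-image (finite⇒listable PI.finE) (λ e → g (P.up e)) λ h → P.inp h , subst (λ z → h ∈ g z) (sym (P.inpUp h)) (here refl)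
    where
    g : P.V ⊎ H → List H
    g (inj₁ _) = []
    g (inj₂ h) = h ∷ []

  listable-K : Listable K
  listable-K = listable-image (finite⇒listable QI.finE) (λ e → g (Q.lo e)) λ k → Q.out k , subst (λ z → k ∈ g z) (sym (Q.outLo k)) (here refl)
    where
    g : Q.V ⊎ K → List K
    g (inj₁ _) = []
    g (inj₂ h) = h ∷ []

  decEq-H : DecidableEquality H
  decEq-H h h' with finite⇒decEq PI.finE (P.inp h) (P.inp h')
  ... | yes p = yes (inj₂-injective (trans (sym (P.inpUp h)) (trans (cong P.up p) (P.inpUp h'))))
  ... | no n = no λ { refl → n refl }

  decEq-K : DecidableEquality K
  decEq-K h h' with finite⇒decEq QI.finE (Q.out h) (Q.out h')
  ... | yes p = yes (inj₂-injective (trans (sym (Q.outLo h)) (trans (cong Q.lo p) (Q.outLo h'))))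
  ... | no n = no λ { refl → n refl }

  finite-CV : Finite CV
  finite-CV = listable⇒finite (Sum.≡-dec (finite⇒decEq PI.finV) (Sum.≡-dec (finite⇒decEq QI.finV) (Sum.≡-dec decEq-H decEq-K)))
                   (listable-⊎ (finite⇒listable PI.finV) (listable-⊎ (finite⇒listable QI.finV) (listable-⊎ listable-H listable-K)))

  finite-CE : Finite CE
  finite-CE = listable⇒finite (Sum.≡-dec (finite⇒decEq PI.finE) (Sum.≡-dec (decEq-Keep _ (finite⇒decEq QI.finE)) (Sum.≡-dec decEq-H decEq-K)))
                   (listable-⊎ (finite⇒listable PI.finE) (listable-⊎ (listable-Keep _ (finite⇒listable QI.finE)) (listable-⊎ listable-H listable-K)))

  -- Degrees.  An edge of C incident to a vertex of D'' is an edge of D''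
  -- other than ε̂₂, or ε̃₃ standing for ε̂₂; fromQ reads it back in D''.

  fromQ : CE → Q.E
  fromQ (inj₂ (inj₁ (e , _))) = e
  fromQ _ = ε̂₂

  upperDeg-P : ∀ v → Exactly CE (λ c → clo c ≡ inj₁ (pV v)) (nUp (P.kind v))
  upperDeg-P v = Exactly-push (PI.upperDeg v) inj₁ (λ a p → cong (λ z → inj₁ (loP z)) p) (λ { a .a _ _ refl → refl })
    λ { (inj₁ e) p → e , loP-p (P.lo e) v (inj₁-injective p) , refl
      ; (inj₂ (inj₁ (e , _))) p → ⊥-elim (loQ-p (Q.lo e) v (inj₁-injective p))
      ; (inj₂ (inj₂ (inj₁ i))) () ; (inj₂ (inj₂ (inj₂ j))) () }

  lowerDeg-P : ∀ v → Exactly CE (λ c → cup c ≡ inj₁ (pV v)) (nLow (P.kind v))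
  lowerDeg-P v = Exactly-push (PI.lowerDeg v) inj₁ (λ a p → cong cupP p) (λ { a .a _ _ refl → refl })
    λ { (inj₁ e) p → e , cupP-p (P.up e) v p , refl
      ; (inj₂ (inj₁ (e , t))) p → ⊥-elim (upQ-p (Q.up e) t v p)
      ; (inj₂ (inj₂ (inj₁ i))) () ; (inj₂ (inj₂ (inj₂ j))) () }

  lowerDeg-Q : ∀ w → Exactly CE (λ c → cup c ≡ inj₁ (qV w)) (nLow (Q.kind w))
  lowerDeg-Q w = Exactly-pull (QI.lowerDeg w) fromQ
    (λ { (inj₁ e) p → ⊥-elim (cupP-q (P.up e) w p)
       ; (inj₂ (inj₁ (e , t))) p → upQ-q (Q.up e) t w p
       ; (inj₂ (inj₂ (inj₁ i))) () ; (inj₂ (inj₂ (inj₂ j))) () })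
    (λ { (inj₁ e) _ p _ _ → ⊥-elim (cupP-q (P.up e) w p)
       ; (inj₂ (inj₁ _)) (inj₁ e) _ p _ → ⊥-elim (cupP-q (P.up e) w p)
       ; (inj₂ (inj₁ (e , t))) (inj₂ (inj₁ (e' , t'))) _ _ q → cong (λ z → inj₂ (inj₁ z)) (Keep-≡ q)
       ; (inj₂ (inj₂ (inj₁ i))) _ () _ _ ; (inj₂ (inj₂ (inj₂ j))) _ () _ _
       ; (inj₂ (inj₁ _)) (inj₂ (inj₂ (inj₁ i))) _ () _ ; (inj₂ (inj₁ _)) (inj₂ (inj₂ (inj₂ j))) _ () _ })
    λ e p → inj₂ (inj₁ (e , subst (λ s → T (not (isSlot s))) (sym p) tt)) ,
            upQ-fwd (Q.up e) p _ , refl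
    where
    upQ-fwd : ∀ s → s ≡ inj₁ w → (t : T (not (isSlot s))) → upQ s t ≡ inj₁ (qV w)
    upQ-fwd .(inj₁ w) refl t = refl

  ε̃₃-lo : P.lo (ε̃₃) ≡ inj₂ (inj₂ tt)
  ε̃₃-lo = P.outLo (inj₂ tt)

  clo-ε̃₃ : clo (inj₁ (ε̃₃)) ≡ inj₁ (loQ slotLo)
  clo-ε̃₃ = cong (λ z → inj₁ (loP z)) ε̃₃-lo

  upperDeg-Q : ∀ w → Exactly CE (λ c → clo c ≡ inj₁ (qV w)) (nUp (Q.kind w))
  upperDeg-Q w = Exactly-pull (QI.upperDeg w) fromQ
    (λ { (inj₁ e) p → proj₂ (loP-q (P.lo e) w (inj₁-injective p))
       ; (inj₂ (inj₁ (e , t))) p → loQ-q (Q.lo e) w (inj₁-injective p)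
       ; (inj₂ (inj₂ (inj₁ i))) () ; (inj₂ (inj₂ (inj₂ j))) () })
    (λ { (inj₁ e) (inj₁ e') p p' _ → cong inj₁ (trans (PI.outUniq e (inj₂ tt) (proj₁ (loP-q (P.lo e) w (inj₁-injective p))))
                                        (sym (PI.outUniq e' (inj₂ tt) (proj₁ (loP-q (P.lo e') w (inj₁-injective p'))))))
       ; (inj₁ e) (inj₂ (inj₁ k)) _ _ q → ⊥-elim (keptNotSlot k (sym q))
       ; (inj₂ (inj₁ k)) (inj₁ e) _ _ q → ⊥-elim (keptNotSlot k q)
       ; (inj₂ (inj₁ (e , t))) (inj₂ (inj₁ (e' , t'))) _ _ q → cong (λ z → inj₂ (inj₁ z)) (Keep-≡ q)
       ; (inj₂ (inj₂ (inj₁ i))) _ () _ _ ; (inj₂ (inj₂ (inj₂ j))) _ () _ _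
       ; (inj₁ _) (inj₂ (inj₂ (inj₁ i))) _ () _ ; (inj₁ _) (inj₂ (inj₂ (inj₂ j))) _ () _
       ; (inj₂ (inj₁ _)) (inj₂ (inj₂ (inj₁ i))) _ () _ ; (inj₂ (inj₁ _)) (inj₂ (inj₂ (inj₂ j))) _ () _ })
    cov
    where
    cov : ∀ e → Q.lo e ≡ inj₁ w → Σ CE λ b → clo b ≡ inj₁ (qV w) × fromQ b ≡ e
    cov e p with isSlot (Q.up e) in eq
    ... | true = inj₁ (ε̃₃) ,
                 trans clo-ε̃₃ (cong (λ z → inj₁ (loQ z)) (trans (cong Q.lo (sym (slotEdge e eq))) p)) ,
                 sym (slotEdge e eq)
    ... | false = inj₂ (inj₁ (mkKQ e eq)) , cong (λ z → inj₁ (loQ z)) p , refl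

  upQ-coctr : ∀ s i → s ≡ inj₂ (inj₁ i) → (t : T (not (isSlot s))) → upQ s t ≡ inj₁ (cV i)
  upQ-coctr .(inj₂ (inj₁ i)) i refl t = refl

  qInp-kept : ∀ i → T (not (isSlot (Q.up (Q.inp (inj₁ i)))))
  qInp-kept i = subst (λ s → T (not (isSlot s))) (sym (Q.inpUp (inj₁ i))) tt

  qInp : H → CE
  qInp i = inj₂ (inj₁ (Q.inp (inj₁ i) , qInp-kept i))

  lowerDeg-coctr : ∀ i → Exactly CE (λ c → cup c ≡ inj₁ (cV i)) 2
  lowerDeg-coctr i = exactly2 (inj₁ (P.inp i)) (qInp i) (cong cupP (P.inpUp i))
    (upQ-coctr _ i (Q.inpUp (inj₁ i)) (qInp-kept i)) (λ ())
    λ { (inj₁ e) p → inj₁ (cong inj₁ (PI.inpUniq e i (cupP-c (P.up e) i p)))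
      ; (inj₂ (inj₁ (e , t))) p → inj₂ (cong (λ z → inj₂ (inj₁ z)) (Keep-≡ (QI.inpUniq e (inj₁ i) (upQ-c (Q.up e) t i p))))
      ; (inj₂ (inj₂ (inj₁ i'))) () ; (inj₂ (inj₂ (inj₂ j))) () }

  upperDeg-coctr : ∀ i → Exactly CE (λ c → clo c ≡ inj₁ (cV i)) 1
  upperDeg-coctr i = exactly1 (hE i) refl
    λ { (inj₁ e) p → ⊥-elim (loP-c (P.lo e) i (inj₁-injective p))
      ; (inj₂ (inj₁ (e , t))) p → ⊥-elim (loQ-c (Q.lo e) i (inj₁-injective p))
      ; (inj₂ (inj₂ (inj₁ i'))) refl → refl ; (inj₂ (inj₂ (inj₂ j))) () }

  lowerDeg-ctr : ∀ j → Exactly CE (λ c → cup c ≡ inj₁ (tV j)) 1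
  lowerDeg-ctr j = exactly1 (kE j) refl
    λ { (inj₁ e) p → ⊥-elim (cupP-t (P.up e) j p)
      ; (inj₂ (inj₁ (e , t))) p → ⊥-elim (upQ-t (Q.up e) t j p)
      ; (inj₂ (inj₂ (inj₁ i'))) () ; (inj₂ (inj₂ (inj₂ j'))) refl → refl }

  -- The upper edges of the contraction j are the lower edge j of D' and
  -- the lower edge j of D'' (which is ε̃₃ if that edge is ε̂₂).
  secondUpper : ∀ j (b : Bool) → isSlot (Q.up (Q.out j)) ≡ b → CE
  secondUpper j true _ = inj₁ (ε̃₃)
  secondUpper j false eq = inj₂ (inj₁ (mkKQ (Q.out j) eq))

  secondUpper-lo : ∀ j b eq → clo (secondUpper j b eq) ≡ inj₁ (tV j)
  secondUpper-lo j true eq = trans clo-ε̃₃ (cong (λ z → inj₁ (loQ z)) (trans (cong Q.lo (sym (slotEdge (Q.out j) eq))) (Q.outLo j)))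
  secondUpper-lo j false eq = cong (λ z → inj₁ (loQ z)) (Q.outLo j)

  secondUpper-≢ : ∀ j b eq → inj₁ (P.out (inj₁ j)) ≢ secondUpper j b eq
  secondUpper-≢ j true eq p with trans (sym (P.outLo (inj₁ j))) (trans (cong P.lo (inj₁-injective p)) ε̃₃-lo)
  ... | ()
  secondUpper-≢ j false eq ()

  upperDeg-ctr : ∀ j → Exactly CE (λ c → clo c ≡ inj₁ (tV j)) 2
  upperDeg-ctr j = exactly2 (inj₁ (P.out (inj₁ j))) (secondUpper j _ refl) (cong (λ z → inj₁ (loP z)) (P.outLo (inj₁ j)))
    (secondUpper-lo j _ refl) (secondUpper-≢ j _ refl) cov
    where
    covS : ∀ (b : Bool) (eq : isSlot (Q.up (Q.out j)) ≡ b) c → ε̂₂ ≡ Q.out j → c ≡ inj₁ (ε̃₃) → c ≡ secondUpper j b eq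
    covS true eq c _ p = p
    covS false eq c q p = ⊥-elim (subst (λ s → T (not (isSlot s))) (trans (cong Q.up (sym q)) (Q.inpUp (inj₂ tt))) (subst (λ b → T (not b)) (sym eq) tt))
    covK : ∀ (b : Bool) (eq : isSlot (Q.up (Q.out j)) ≡ b) (k : KQ) → proj₁ k ≡ Q.out j → inj₂ (inj₁ k) ≡ secondUpper j b eq
    covK true eq k q = ⊥-elim (keptNotSlot k (trans q (slotEdge (Q.out j) eq)))
    covK false eq k q = cong (λ z → inj₂ (inj₁ z)) (Keep-≡ q)
    cov : ∀ c → clo c ≡ inj₁ (tV j) → (c ≡ inj₁ (P.out (inj₁ j))) ⊎ (c ≡ secondUpper j _ refl)
    cov (inj₁ e) p with loP-t (P.lo e) j (inj₁-injective p)
    ... | inj₁ q = inj₁ (cong inj₁ (PI.outUniq e (inj₁ j) q))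
    ... | inj₂ (q , z) = inj₂ (covS _ refl (inj₁ e) (QI.outUniq (ε̂₂) j z) (cong inj₁ (PI.outUniq e (inj₂ tt) q)))
    cov (inj₂ (inj₁ (e , t))) p = inj₂ (covK _ refl (e , t) (QI.outUniq e j (loQ-t (Q.lo e) j (inj₁-injective p))))
    cov (inj₂ (inj₂ (inj₁ i))) ()
    cov (inj₂ (inj₂ (inj₂ j'))) ()

  BelowC : CE → CE → Set
  BelowC = Below C

  belowFromP : ∀ p c' → BelowC (inj₁ p) c' →
    (Σ P.E λ p' → (c' ≡ inj₁ p') × Below D' p p') ⊎
    ((Σ KQ λ k → (c' ≡ qE k) × (P.lo p ≡ inj₂ (inj₂ tt)) × Below D'' ε̂₂ (proj₁ k)) ⊎
     (Σ K λ j → (c' ≡ kE j) × ((P.lo p ≡ inj₂ (inj₁ j)) ⊎ ((P.lo p ≡ inj₂ (inj₂ tt)) × (slotLo ≡ inj₂ j)))))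
  belowFromP p (inj₁ p') (inj₁ v , l , u) = inj₁ (p' , refl , v , loP-p (P.lo p) v (inj₁-injective l) , cupP-p (P.up p') v u)
  belowFromP p (inj₁ p') (inj₂ (inj₁ w) , l , u) = ⊥-elim (cupP-q (P.up p') w u)
  belowFromP p (inj₁ p') (inj₂ (inj₂ (inj₁ i)) , l , u) = ⊥-elim (loP-c (P.lo p) i (inj₁-injective l))
  belowFromP p (inj₁ p') (inj₂ (inj₂ (inj₂ j)) , l , u) = ⊥-elim (cupP-t (P.up p') j u)
  belowFromP p (inj₂ (inj₁ (q , t))) (inj₁ v , l , u) = ⊥-elim (upQ-p (Q.up q) t v u)
  belowFromP p (inj₂ (inj₁ (q , t))) (inj₂ (inj₁ w) , l , u) with loP-q (P.lo p) w (inj₁-injective l)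
  ... | ps , z = inj₂ (inj₁ ((q , t) , refl , ps , w , z , upQ-q (Q.up q) t w u))
  belowFromP p (inj₂ (inj₁ (q , t))) (inj₂ (inj₂ (inj₁ i)) , l , u) = ⊥-elim (loP-c (P.lo p) i (inj₁-injective l))
  belowFromP p (inj₂ (inj₁ (q , t))) (inj₂ (inj₂ (inj₂ j)) , l , u) = ⊥-elim (upQ-t (Q.up q) t j u)
  belowFromP p (inj₂ (inj₂ (inj₁ i))) (v , l , ())
  belowFromP p (inj₂ (inj₂ (inj₂ j'))) (inj₂ (inj₂ (inj₂ j)) , l , refl) = inj₂ (inj₂ (j , refl , loP-t (P.lo p) j (inj₁-injective l)))
  belowFromP p (inj₂ (inj₂ (inj₂ j'))) (inj₁ v , l , ())
  belowFromP p (inj₂ (inj₂ (inj₂ j'))) (inj₂ (inj₁ w) , l , ())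
  belowFromP p (inj₂ (inj₂ (inj₂ j'))) (inj₂ (inj₂ (inj₁ i)) , l , ())

  belowFromQ : ∀ k c' → BelowC (qE k) c' →
    (Σ KQ λ k' → (c' ≡ qE k') × Below D'' (proj₁ k) (proj₁ k')) ⊎ (Σ K λ j → (c' ≡ kE j) × (Q.lo (proj₁ k) ≡ inj₂ j))
  belowFromQ (q , t) c' (inj₁ v , l , u) = ⊥-elim (loQ-p (Q.lo q) v (inj₁-injective l))
  belowFromQ (q , t) c' (inj₂ (inj₂ (inj₁ i)) , l , u) = ⊥-elim (loQ-c (Q.lo q) i (inj₁-injective l))
  belowFromQ (q , t) (inj₁ p') (inj₂ (inj₁ w) , l , u) = ⊥-elim (cupP-q (P.up p') w u)
  belowFromQ (q , t) (inj₂ (inj₁ (q' , t'))) (inj₂ (inj₁ w) , l , u) =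
    inj₁ ((q' , t') , refl , w , loQ-q (Q.lo q) w (inj₁-injective l) , upQ-q (Q.up q') t' w u)
  belowFromQ (q , t) (inj₂ (inj₂ (inj₁ i))) (inj₂ (inj₁ w) , l , ())
  belowFromQ (q , t) (inj₂ (inj₂ (inj₂ j))) (inj₂ (inj₁ w) , l , ())
  belowFromQ (q , t) (inj₁ p') (inj₂ (inj₂ (inj₂ j)) , l , u) = ⊥-elim (cupP-t (P.up p') j u)
  belowFromQ (q , t) (inj₂ (inj₁ (q' , t'))) (inj₂ (inj₂ (inj₂ j)) , l , u) = ⊥-elim (upQ-t (Q.up q') t' j u)
  belowFromQ (q , t) (inj₂ (inj₂ (inj₁ i))) (inj₂ (inj₂ (inj₂ j)) , l , ())
  belowFromQ (q , t) (inj₂ (inj₂ (inj₂ j'))) (inj₂ (inj₂ (inj₂ j)) , l , refl) = inj₂ (j , refl , loQ-t (Q.lo q) j (inj₁-injective l))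

  belowFromH : ∀ i c' → BelowC (hE i) c' → (c' ≡ inj₁ (P.inp i)) ⊎ (c' ≡ qInp i)
  belowFromH i (inj₁ p') (.(inj₂ (inj₂ (inj₁ i))) , refl , u) = inj₁ (cong inj₁ (PI.inpUniq p' i (cupP-c (P.up p') i u)))
  belowFromH i (inj₂ (inj₁ (q , t))) (.(inj₂ (inj₂ (inj₁ i))) , refl , u) =
    inj₂ (cong (λ z → inj₂ (inj₁ z)) (Keep-≡ (QI.inpUniq q (inj₁ i) (upQ-c (Q.up q) t i u))))
  belowFromH i (inj₂ (inj₂ (inj₁ i'))) (.(inj₂ (inj₂ (inj₁ i))) , refl , ())
  belowFromH i (inj₂ (inj₂ (inj₂ j))) (.(inj₂ (inj₂ (inj₁ i))) , refl , ())

  belowFromK : ∀ j c' → BelowC (kE j) c' → ⊥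
  belowFromK j c' (v , () , u)

  reachFromK : ∀ j c → CP.Reach (kE j) c → c ≡ kE j
  reachFromK j c CP.rnil = refl
  reachFromK j c (CP.rcons {e₁ = c₁} b r) = ⊥-elim (belowFromK j c₁ b)

  reachFromQ : ∀ k c → CP.Reach (qE k) c →
    (Σ KQ λ k' → (c ≡ qE k') × QP.Reach (proj₁ k) (proj₁ k')) ⊎ (Σ K λ j → (c ≡ kE j) × QP.Reach (proj₁ k) (Q.out j))
  reachFromQ k c CP.rnil = inj₁ (k , refl , QP.rnil)
  reachFromQ k c (CP.rcons {e₁ = c₁} b r) with belowFromQ k c₁ b
  ... | inj₁ (k' , refl , b') with reachFromQ k' c r
  ...   | inj₁ (k'' , eq , r') = inj₁ (k'' , eq , QP.rcons b' r')
  ...   | inj₂ (j , eq , r') = inj₂ (j , eq , QP.rcons b' r')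
  reachFromQ k c (CP.rcons {e₁ = c₁} b r) | inj₂ (j , refl , l) =
    inj₂ (j , reachFromK j c r , subst (QP.Reach (proj₁ k)) (QI.outUniq (proj₁ k) j l) QP.rnil)

  data ReachFromP (p : P.E) (c : CE) : Set where
    rp-p : ∀ p' → c ≡ inj₁ p' → PP.Reach p p' → ReachFromP p c
    rp-q : ∀ k → c ≡ qE k → PP.Reach p ε̃₃ → QP.Reach ε̂₂ (proj₁ k) → ReachFromP p c
    rp-k1 : ∀ j → c ≡ kE j → PP.Reach p (P.out (inj₁ j)) → ReachFromP p c
    rp-k2 : ∀ j → c ≡ kE j → PP.Reach p ε̃₃ → QP.Reach ε̂₂ (Q.out j) → ReachFromP p c

  reachFromP : ∀ p c → CP.Reach (inj₁ p) c → ReachFromP p c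
  reachFromP p c CP.rnil = rp-p p refl PP.rnil
  reachFromP p c (CP.rcons {e₁ = c₁} b r) with belowFromP p c₁ b
  ... | inj₁ (p' , refl , b') with reachFromP p' c r
  ...   | rp-p p'' e r' = rp-p p'' e (PP.rcons b' r')
  ...   | rp-q k e r1 r2 = rp-q k e (PP.rcons b' r1) r2
  ...   | rp-k1 j e r' = rp-k1 j e (PP.rcons b' r')
  ...   | rp-k2 j e r1 r2 = rp-k2 j e (PP.rcons b' r1) r2
  reachFromP p c (CP.rcons {e₁ = c₁} b r) | inj₂ (inj₁ (k , refl , ps , b')) with reachFromQ k c r
  ... | inj₁ (k' , e , r') = rp-q k' e (subst (PP.Reach p) (PI.outUniq p (inj₂ tt) ps) PP.rnil) (QP.rcons b' r')
  ... | inj₂ (j , e , r') = rp-k2 j e (subst (PP.Reach p) (PI.outUniq p (inj₂ tt) ps) PP.rnil) (QP.rcons b' r')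
  reachFromP p c (CP.rcons {e₁ = c₁} b r) | inj₂ (inj₂ (j , refl , inj₁ l)) =
    rp-k1 j (reachFromK j c r) (subst (PP.Reach p) (PI.outUniq p (inj₁ j) l) PP.rnil)
  reachFromP p c (CP.rcons {e₁ = c₁} b r) | inj₂ (inj₂ (j , refl , inj₂ (ps , z))) =
    rp-k2 j (reachFromK j c r) (subst (PP.Reach p) (PI.outUniq p (inj₂ tt) ps) PP.rnil)
      (subst (QP.Reach ε̂₂) (QI.outUniq ε̂₂ j z) QP.rnil)

  acyclic-P : PP.Acyclic
  acyclic-P = PP.noDirectedCycle⇒acyclic PI.acyclic
  acyclic-Q : QP.Acyclic
  acyclic-Q = QP.noDirectedCycle⇒acyclic QI.acyclic

  -- C is acyclic: a directed cycle would have to stay in D' or in D''.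
  acyclic-comb : CP.Acyclic
  acyclic-comb (inj₁ p) b bl r with belowFromP p b bl
  ... | inj₁ (p' , refl , b') with reachFromP p' (inj₁ p) r
  ...   | rp-p p'' refl r' = acyclic-P p p' b' r'
  ...   | rp-q k () _ _
  ...   | rp-k1 j () _
  ...   | rp-k2 j () _ _
  acyclic-comb (inj₁ p) b bl r | inj₂ (inj₁ (k , refl , _ , _)) with reachFromQ k (inj₁ p) r
  ...   | inj₁ (_ , () , _)
  ...   | inj₂ (_ , () , _)
  acyclic-comb (inj₁ p) b bl r | inj₂ (inj₂ (j , refl , _)) with reachFromK j (inj₁ p) r
  ...   | ()
  acyclic-comb (inj₂ (inj₁ k)) b bl r with belowFromQ k b bl
  ... | inj₁ (k' , refl , b') with reachFromQ k' (qE k) r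
  ...   | inj₁ (k'' , refl , r') = acyclic-Q (proj₁ k) (proj₁ k') b' r'
  ...   | inj₂ (_ , () , _)
  acyclic-comb (inj₂ (inj₁ k)) b bl r | inj₂ (j , refl , _) with reachFromK j (qE k) r
  ...   | ()
  acyclic-comb (inj₂ (inj₂ (inj₁ i))) b bl r with belowFromH i b bl
  ... | inj₁ refl with reachFromP (P.inp i) (hE i) r
  ...   | rp-p _ () _
  ...   | rp-q k () _ _
  ...   | rp-k1 j () _
  ...   | rp-k2 j () _ _
  acyclic-comb (inj₂ (inj₂ (inj₁ i))) b bl r | inj₂ refl with reachFromQ _ (hE i) r
  ...   | inj₁ (_ , () , _)
  ...   | inj₂ (_ , () , _)
  acyclic-comb (inj₂ (inj₂ (inj₂ j))) b bl r = belowFromK j b bl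

  IncidentC : CE → CV → Set
  IncidentC = Incident C

  incP : ∀ c v → IncidentC c (pV v) → Σ P.E λ e → (c ≡ inj₁ e) × Incident D' e v
  incP (inj₁ e) v (inj₁ u) = e , refl , inj₁ (cupP-p (P.up e) v u)
  incP (inj₁ e) v (inj₂ l) = e , refl , inj₂ (loP-p (P.lo e) v (inj₁-injective l))
  incP (inj₂ (inj₁ (q , t))) v (inj₁ u) = ⊥-elim (upQ-p (Q.up q) t v u)
  incP (inj₂ (inj₁ (q , t))) v (inj₂ l) = ⊥-elim (loQ-p (Q.lo q) v (inj₁-injective l))
  incP (inj₂ (inj₂ (inj₁ i))) v (inj₁ ())
  incP (inj₂ (inj₂ (inj₁ i))) v (inj₂ ())
  incP (inj₂ (inj₂ (inj₂ j))) v (inj₁ ())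
  incP (inj₂ (inj₂ (inj₂ j))) v (inj₂ ())

  incQ-shape : ∀ c w → IncidentC c (qV w) → (c ≡ inj₁ ε̃₃) ⊎ (Σ KQ λ k → c ≡ qE k)
  incQ-shape (inj₁ e) w (inj₁ u) = ⊥-elim (cupP-q (P.up e) w u)
  incQ-shape (inj₁ e) w (inj₂ l) = inj₁ (cong inj₁ (PI.outUniq e (inj₂ tt) (proj₁ (loP-q (P.lo e) w (inj₁-injective l)))))
  incQ-shape (inj₂ (inj₁ k)) w i = inj₂ (k , refl)
  incQ-shape (inj₂ (inj₂ (inj₁ x))) w (inj₁ ())
  incQ-shape (inj₂ (inj₂ (inj₁ x))) w (inj₂ ())
  incQ-shape (inj₂ (inj₂ (inj₂ x))) w (inj₁ ())
  incQ-shape (inj₂ (inj₂ (inj₂ x))) w (inj₂ ())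

  incQ-inj : ∀ c c' w → IncidentC c (qV w) → IncidentC c' (qV w) → fromQ c ≡ fromQ c' → c ≡ c'
  incQ-inj c c' w i i' q with incQ-shape c w i | incQ-shape c' w i'
  ... | inj₁ refl | inj₁ refl = refl
  ... | inj₁ refl | inj₂ (k , refl) = ⊥-elim (keptNotSlot k (sym q))
  ... | inj₂ (k , refl) | inj₁ refl = ⊥-elim (keptNotSlot k q)
  ... | inj₂ (k , refl) | inj₂ (k' , refl) = cong qE (Keep-≡ q)

  module WithMatchingPolarities (pol-inp : ∀ i → Q.pol (Q.inp (inj₁ i)) ≡ P.pol (P.inp i))
             (pol-out : ∀ j → P.pol (P.out (inj₁ j)) ≡ Q.pol (Q.out j))
             (pol-slot : P.pol ε̃₃ ≡ Q.pol ε̂₂) where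

    incQ : ∀ c w → IncidentC c (qV w) → Incident D'' (fromQ c) w × (cpol c ≡ Q.pol (fromQ c))
    incQ (inj₁ e) w (inj₁ u) = ⊥-elim (cupP-q (P.up e) w u)
    incQ (inj₁ e) w (inj₂ l) with loP-q (P.lo e) w (inj₁-injective l)
    ... | ps , z = inj₂ z , trans (cong P.pol (PI.outUniq e (inj₂ tt) ps)) pol-slot
    incQ (inj₂ (inj₁ (q , t))) w (inj₁ u) = inj₁ (upQ-q (Q.up q) t w u) , refl
    incQ (inj₂ (inj₁ (q , t))) w (inj₂ l) = inj₂ (loQ-q (Q.lo q) w (inj₁-injective l)) , refl
    incQ (inj₂ (inj₂ (inj₁ i))) w (inj₁ ())
    incQ (inj₂ (inj₂ (inj₁ i))) w (inj₂ ())
    incQ (inj₂ (inj₂ (inj₂ j))) w (inj₁ ())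
    incQ (inj₂ (inj₂ (inj₂ j))) w (inj₂ ())

    incCo : ∀ c i → IncidentC c (cV i) → cpol c ≡ P.pol (P.inp i)
    incCo (inj₁ e) i (inj₁ u) = cong P.pol (PI.inpUniq e i (cupP-c (P.up e) i u))
    incCo (inj₁ e) i (inj₂ l) = ⊥-elim (loP-c (P.lo e) i (inj₁-injective l))
    incCo (inj₂ (inj₁ (q , t))) i (inj₁ u) = trans (cong Q.pol (QI.inpUniq q (inj₁ i) (upQ-c (Q.up q) t i u))) (pol-inp i)
    incCo (inj₂ (inj₁ (q , t))) i (inj₂ l) = ⊥-elim (loQ-c (Q.lo q) i (inj₁-injective l))
    incCo (inj₂ (inj₂ (inj₁ i'))) i (inj₁ ())
    incCo (inj₂ (inj₂ (inj₁ i'))) i (inj₂ refl) = refl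
    incCo (inj₂ (inj₂ (inj₂ j))) i (inj₁ ())
    incCo (inj₂ (inj₂ (inj₂ j))) i (inj₂ ())

    incT : ∀ c j → IncidentC c (tV j) → cpol c ≡ Q.pol (Q.out j)
    incT (inj₁ e) j (inj₁ u) = ⊥-elim (cupP-t (P.up e) j u)
    incT (inj₁ e) j (inj₂ l) with loP-t (P.lo e) j (inj₁-injective l)
    ... | inj₁ q = trans (cong P.pol (PI.outUniq e (inj₁ j) q)) (pol-out j)
    ... | inj₂ (ps , z) = trans (cong P.pol (PI.outUniq e (inj₂ tt) ps)) (trans pol-slot (cong Q.pol (QI.outUniq ε̂₂ j z)))
    incT (inj₂ (inj₁ (q , t))) j (inj₁ u) = ⊥-elim (upQ-t (Q.up q) t j u)
    incT (inj₂ (inj₁ (q , t))) j (inj₂ l) = cong Q.pol (QI.outUniq q j (loQ-t (Q.lo q) j (inj₁-injective l)))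
    incT (inj₂ (inj₂ (inj₁ i))) j (inj₁ ())
    incT (inj₂ (inj₂ (inj₁ i))) j (inj₂ ())
    incT (inj₂ (inj₂ (inj₂ j'))) j (inj₁ refl) = refl
    incT (inj₂ (inj₂ (inj₂ j'))) j (inj₂ ())

    isFlow-comb : IsFlow C
    isFlow-comb = record
      { finV = finite-CV ; finE = finite-CE
      ; inpUniq = λ { (inj₁ e) i p → ⊥-elim (cupP-2 (P.up e) i p)
                    ; (inj₂ (inj₁ (q , t))) i p → ⊥-elim (upQ-2 (Q.up q) t i p)
                    ; (inj₂ (inj₂ (inj₁ i'))) i refl → refl
                    ; (inj₂ (inj₂ (inj₂ j))) i () }
      ; outUniq = λ { (inj₁ e) j () ; (inj₂ (inj₁ (q , t))) j () ; (inj₂ (inj₂ (inj₁ i))) j ()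
                    ; (inj₂ (inj₂ (inj₂ j'))) j refl → refl }
      ; upperDeg = λ { (inj₁ v) → upperDeg-P v ; (inj₂ (inj₁ w)) → upperDeg-Q w ; (inj₂ (inj₂ (inj₁ i))) → upperDeg-coctr i
                     ; (inj₂ (inj₂ (inj₂ j))) → upperDeg-ctr j }
      ; lowerDeg = λ { (inj₁ v) → lowerDeg-P v ; (inj₂ (inj₁ w)) → lowerDeg-Q w ; (inj₂ (inj₂ (inj₁ i))) → lowerDeg-coctr i
                     ; (inj₂ (inj₂ (inj₂ j))) → lowerDeg-ctr j }
      ; acyclic = CP.acyclic⇒noDirectedCycle acyclic-comb
      ; polCtr = polCtr-comb
      ; polInt = polInt-comb
      }
      where
      polCtr-comb : ∀ v → (ckind v ≡ ctr ⊎ ckind v ≡ coctr) → ∀ c c' → IncidentC c v → IncidentC c' v → cpol c ≡ cpol c'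
      polCtr-comb (inj₁ v) k c c' i i' with incP c v i | incP c' v i'
      ... | e , refl , ie | e' , refl , ie' = PI.polCtr v k e e' ie ie'
      polCtr-comb (inj₂ (inj₁ w)) k c c' i i' with incQ c w i | incQ c' w i'
      ... | ie , pe | ie' , pe' = trans pe (trans (QI.polCtr w k _ _ ie ie') (sym pe'))
      polCtr-comb (inj₂ (inj₂ (inj₁ x))) k c c' i i' = trans (incCo c x i) (sym (incCo c' x i'))
      polCtr-comb (inj₂ (inj₂ (inj₂ x))) k c c' i i' = trans (incT c x i) (sym (incT c' x i'))
      polInt-comb : ∀ v → (ckind v ≡ int ⊎ ckind v ≡ coint) → ∀ c c' → IncidentC c v → IncidentC c' v → c ≢ c' → cpol c ≢ cpol c'
      polInt-comb (inj₁ v) k c c' i i' ne with incP c v i | incP c' v i'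
      ... | e , refl , ie | e' , refl , ie' = PI.polInt v k e e' ie ie' (λ q → ne (cong inj₁ q))
      polInt-comb (inj₂ (inj₁ w)) k c c' i i' ne q with incQ c w i | incQ c' w i'
      ... | ie , pe | ie' , pe' = QI.polInt w k _ _ ie ie' (λ r → ne (incQ-inj c c' w i i' r)) (trans (sym pe) (trans q pe'))
      polInt-comb (inj₂ (inj₂ (inj₁ x))) (inj₁ ()) 
      polInt-comb (inj₂ (inj₂ (inj₁ x))) (inj₂ ())
      polInt-comb (inj₂ (inj₂ (inj₂ x))) (inj₁ ())
      polInt-comb (inj₂ (inj₂ (inj₂ x))) (inj₂ ())


  intRoot-comb : ∀ c → CP.IntRoot c → (Σ P.E λ p → (c ≡ inj₁ p) × PP.IntRoot p) ⊎ (Σ KQ λ k → (c ≡ qE k) × QP.IntRoot (proj₁ k))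
  intRoot-comb (inj₁ p) (inj₁ v , u , k) = inj₁ (p , refl , v , cupP-p (P.up p) v u , k)
  intRoot-comb (inj₁ p) (inj₂ (inj₁ w) , u , k) = ⊥-elim (cupP-q (P.up p) w u)
  intRoot-comb (inj₁ p) (inj₂ (inj₂ (inj₁ i)) , u , ())
  intRoot-comb (inj₁ p) (inj₂ (inj₂ (inj₂ j)) , u , ())
  intRoot-comb (inj₂ (inj₁ (q , t))) (inj₁ v , u , k) = ⊥-elim (upQ-p (Q.up q) t v u)
  intRoot-comb (inj₂ (inj₁ (q , t))) (inj₂ (inj₁ w) , u , k) = inj₂ ((q , t) , refl , w , upQ-q (Q.up q) t w u , k)
  intRoot-comb (inj₂ (inj₁ (q , t))) (inj₂ (inj₂ (inj₁ i)) , u , ())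
  intRoot-comb (inj₂ (inj₁ (q , t))) (inj₂ (inj₂ (inj₂ j)) , u , ())
  intRoot-comb (inj₂ (inj₂ (inj₁ i))) (v , () , k)
  intRoot-comb (inj₂ (inj₂ (inj₂ j))) (.(inj₂ (inj₂ (inj₂ j))) , refl , ())

  data CointBotView (c : CE) : Set where
    cb-p : ∀ p → c ≡ inj₁ p → PP.CointBot p → CointBotView c
    cb-q : ∀ k → c ≡ qE k → QP.CointBot (proj₁ k) → CointBotView c
    cb-s : c ≡ inj₁ ε̃₃ → QP.CointBot ε̂₂ → CointBotView c

  cointBot-comb : ∀ c → CP.CointBot c → CointBotView c
  cointBot-comb (inj₁ p) (inj₁ v , l , k) = cb-p p refl (v , loP-p (P.lo p) v (inj₁-injective l) , k)
  cointBot-comb (inj₁ p) (inj₂ (inj₁ w) , l , k) with loP-q (P.lo p) w (inj₁-injective l)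
  ... | ps , z = cb-s (cong inj₁ (PI.outUniq p (inj₂ tt) ps)) (w , z , k)
  cointBot-comb (inj₁ p) (inj₂ (inj₂ (inj₁ i)) , l , ())
  cointBot-comb (inj₁ p) (inj₂ (inj₂ (inj₂ j)) , l , ())
  cointBot-comb (inj₂ (inj₁ (q , t))) (inj₁ v , l , k) = ⊥-elim (loQ-p (Q.lo q) v (inj₁-injective l))
  cointBot-comb (inj₂ (inj₁ (q , t))) (inj₂ (inj₁ w) , l , k) = cb-q (q , t) refl (w , loQ-q (Q.lo q) w (inj₁-injective l) , k)
  cointBot-comb (inj₂ (inj₁ (q , t))) (inj₂ (inj₂ (inj₁ i)) , l , ())
  cointBot-comb (inj₂ (inj₁ (q , t))) (inj₂ (inj₂ (inj₂ j)) , l , ())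
  cointBot-comb (inj₂ (inj₂ (inj₁ i))) (.(inj₂ (inj₂ (inj₁ i))) , refl , ())
  cointBot-comb (inj₂ (inj₂ (inj₂ j))) (v , () , k)

  noCointBot-out : ∀ j → CP.CointBot (kE j) → ⊥
  noCointBot-out j (v , () , k)

  combIntAbove : ∀ j → CP.IntAbove j → PP.IntAbove (inj₁ j) ⊎ (QP.IntAbove j ⊎ (PP.IntAbove (inj₂ tt) × QP.Through (inj₂ tt) j))
  combIntAbove j (c , ir , r) with intRoot-comb c ir
  ... | inj₁ (p , refl , ir') with reachFromP p (kE j) r
  ...   | rp-p _ () _
  ...   | rp-q _ () _ _
  ...   | rp-k1 j' refl r' = inj₁ (p , ir' , r')
  ...   | rp-k2 j' refl r1 r2 = inj₂ (inj₂ ((p , ir' , r1) , r2))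
  combIntAbove j (c , ir , r) | inj₂ (k , refl , ir') with reachFromQ k (kE j) r
  ...   | inj₁ (_ , () , _)
  ...   | inj₂ (j' , refl , r') = inj₂ (inj₁ (proj₁ k , ir' , r'))

  combThrough : ∀ i j → CP.Through i j → PP.Through i (inj₁ j) ⊎ (QP.Through (inj₁ i) j ⊎ (PP.Through i (inj₂ tt) × QP.Through (inj₂ tt) j))
  combThrough i j (CP.rcons {e₁ = c₁} b r) with belowFromH i c₁ b
  ... | inj₁ refl with reachFromP (P.inp i) (kE j) r
  ...   | rp-p _ () _
  ...   | rp-q _ () _ _
  ...   | rp-k1 j' refl r' = inj₁ r'
  ...   | rp-k2 j' refl r1 r2 = inj₂ (inj₂ (r1 , r2))
  combThrough i j (CP.rcons {e₁ = c₁} b r) | inj₂ refl with reachFromQ _ (kE j) r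
  ...   | inj₁ (_ , () , _)
  ...   | inj₂ (j' , refl , r') = inj₂ (inj₁ r')

  toCointFromQ : ∀ k l → CP.Reach (qE k) l → CP.CointBot l → Σ Q.E λ q → QP.Reach (proj₁ k) q × QP.CointBot q
  toCointFromQ k l r cb with reachFromQ k l r
  ... | inj₂ (j , refl , _) = ⊥-elim (noCointBot-out j cb)
  ... | inj₁ (k' , refl , r') with cointBot-comb (qE k') cb
  ...   | cb-p _ () _
  ...   | cb-q _ refl cb' = proj₁ k' , r' , cb'
  ...   | cb-s () _

  toCointFromP : ∀ p l → CP.Reach (inj₁ p) l → CP.CointBot l →
    (Σ P.E λ p' → PP.Reach p p' × PP.CointBot p') ⊎ (PP.Reach p ε̃₃ × QP.CointBelow (inj₂ tt))
  toCointFromP p l r cb with reachFromP p l r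
  ... | rp-k1 j refl _ = ⊥-elim (noCointBot-out j cb)
  ... | rp-k2 j refl _ _ = ⊥-elim (noCointBot-out j cb)
  ... | rp-p p' refl r' with cointBot-comb (inj₁ p') cb
  ...   | cb-p _ refl cb' = inj₁ (p' , r' , cb')
  ...   | cb-q _ () _
  ...   | cb-s refl cbq = inj₂ (r' , ε̂₂ , QP.rnil , cbq)
  toCointFromP p l r cb | rp-q k refl r1 r2 with cointBot-comb (qE k) cb
  ...   | cb-p _ () _
  ...   | cb-q _ refl cb' = inj₂ (r1 , proj₁ k , r2 , cb')
  ...   | cb-s () _

  combCointBelow : ∀ i → CP.CointBelow i →
    PP.CointBelow i ⊎ (QP.CointBelow (inj₁ i) ⊎ (PP.Through i (inj₂ tt) × QP.CointBelow (inj₂ tt)))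
  combCointBelow i (l , CP.rnil , (_ , refl , ()))
  combCointBelow i (l , CP.rcons {e₁ = c₁} b r , cb) with belowFromH i c₁ b
  ... | inj₁ refl with toCointFromP (P.inp i) l r cb
  ...   | inj₁ inP = inj₁ inP
  ...   | inj₂ crossing = inj₂ (inj₂ crossing)
  combCointBelow i (l , CP.rcons {e₁ = c₁} b r , cb) | inj₂ refl = inj₂ (inj₁ (toCointFromQ _ l r cb))

  noConn-comb : PP.NoConn → QP.NoConn → ¬ (PP.IntAbove (inj₂ tt) × QP.CointBelow (inj₂ tt)) → CP.NoConn
  noConn-comb ncP ncQ cross e l ir r cb with intRoot-comb e ir
  ... | inj₁ (p , refl , ir') with toCointFromP p l r cb
  ...   | inj₁ (p' , r' , cb') = ncP p p' ir' r' cb'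
  ...   | inj₂ (r' , below) = cross ((p , ir' , r') , below)
  noConn-comb ncP ncQ cross e l ir r cb | inj₂ (k , refl , ir') with toCointFromQ k l r cb
  ...   | q , r' , cb' = ncQ (proj₁ k) q ir' r' cb'

isInt? : (k : Kind) → Dec (k ≡ int)
isInt? int = yes refl
isInt? coint = no λ ()
isInt? wk = no λ ()
isInt? cowk = no λ ()
isInt? ctr = no λ ()
isInt? coctr = no λ ()

isCoint? : (k : Kind) → Dec (k ≡ coint)
isCoint? int = no λ ()
isCoint? coint = yes refl
isCoint? wk = no λ ()
isCoint? cowk = no λ ()
isCoint? ctr = no λ ()
isCoint? coctr = no λ ()

module DecideSimple {H K : Set} (B : Flow H K) where
  open Flow B
  open Paths B

  intRoot? : ∀ e → Dec (IntRoot e)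
  intRoot? e with up e
  ... | inj₂ _ = no λ { (_ , () , _) }
  ... | inj₁ v with isInt? (kind v)
  ...   | yes k = yes (v , refl , k)
  ...   | no n = no λ { (_ , refl , k) → n k }

  cointBot? : ∀ e → Dec (CointBot e)
  cointBot? e with lo e
  ... | inj₂ _ = no λ { (_ , () , _) }
  ... | inj₁ v with isCoint? (kind v)
  ...   | yes k = yes (v , refl , k)
  ...   | no n = no λ { (_ , refl , k) → n k }

  simple? : ∀ e → Dec (SimpleEdge B e)
  simple? e with intRoot? e | cointBot? e
  ... | yes a | yes b = yes (simple← a b)
  ... | no n | _ = no λ s → n (proj₁ (simple→ s))
  ... | _ | no n = no λ s → n (proj₂ (simple→ s))

  someSimple? : (xs : List E) → (∀ e → e ∈ xs) → (Σ E λ e → SimpleEdge B e) ⊎ (∀ e → ¬ SimpleEdge B e)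
  someSimple? xs all∈ with any? simple? xs
  ... | yes s = inj₁ (satisfied s)
  ... | no n = inj₂ λ e s → n (lose (all∈ e) s)

module FindExtremal {H K : Set} (B : Flow H K) (cf : CycleFree B) (clean : AllClean B)
  (decV : DecidableEquality (Flow.V B)) (decE : DecidableEquality (Flow.E B))
  (xs : List (Flow.E B)) (all∈ : ∀ e → e ∈ xs) where
  open Flow B
  open DecideSimple B using (simple?)

  ED : Set
  ED = E × Dir B

  -- ai-paths of a cycle-free flow repeat no edge: a first repetition of an
  -- edge closes an ai-cycle

  splitLinked : ∀ {x y} as bs → Linked (Link B) (x ∷ as ++ y ∷ bs) → Linked (Link B) (x ∷ as) × Link B (lastOf x as) y
  splitLinked [] bs (l ∷ _) = [-] , l
  splitLinked (a ∷ as) bs (l ∷ lk) with splitLinked as bs lk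
  ... | lk' , l' = l ∷ lk' , l'

  uniqueSplit : ∀ (y : ED) as bs → Unique (edges B (as ++ y ∷ bs)) → Unique (edges B as) × ¬ (proj₁ y ∈ edges B as)
  uniqueSplit y [] bs u = [] , λ ()
  uniqueSplit y (a ∷ as) bs (px ∷ u) with uniqueSplit y as bs u
  ... | u' , y∉ = AllP.++⁻ˡ (edges B as) (subst (All (proj₁ a ≢_)) (map-++ proj₁ as (y ∷ bs)) px) ∷ u' ,
        λ { (here q) → All.lookup px (∈-map⁺ proj₁ (∈-++⁺ʳ as (here refl))) (sym q) ; (there m) → y∉ m }

  noReturn : ∀ x as {v} → Linked (Link B) (x ∷ as) → Unique (edges B (x ∷ as)) →
    src B x ≡ just v → tgt B (lastOf x as) ≡ just v → ⊥
  noReturn x as lk u s t = cf (x ∷ as) (lk , u , _ , s , initOf x as , lastOf x as , init-snoc x as , t)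

  turn-distinct : ∀ d d' {v e e'} → d ≢ d' → Turn B d d' v e e' → e ≢ e'
  turn-distinct down down n _ = ⊥-elim (n refl)
  turn-distinct upw upw n _ = ⊥-elim (n refl)
  turn-distinct down upw n (_ , ne) = ne
  turn-distinct upw down n (_ , ne) = ne

  -- Traversing e, then as, then e again in the opposite direction: either
  -- as is empty and e is reversed at a turn, or as is an ai-cycle.
  noReversal : ∀ e d d' as {v} → d ≢ d' → src B (e , d') ≡ tgt B (e , d) →
    Linked (Link B) ((e , d) ∷ as) → Unique (edges B as) →
    tgt B (lastOf (e , d) as) ≡ just v → src B (e , d') ≡ just v →
    Turn B (proj₂ (lastOf (e , d) as)) d' v (proj₁ (lastOf (e , d) as)) e → ⊥
  noReversal e d d' [] ne _ _ _ _ _ tr = turn-distinct d d' ne tr refl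
  noReversal e d d' (a ∷ as) ne st ((v₀ , t₀ , s₀ , _) ∷ lk) u t s _ =
    noReturn a as lk u s₀ (trans t (trans (sym s) (trans st t₀)))

  noRepetition : ∀ e d d' as {v} → Linked (Link B) ((e , d) ∷ as) → Unique (edges B as) → ¬ (e ∈ edges B as) →
    tgt B (lastOf (e , d) as) ≡ just v → src B (e , d') ≡ just v →
    Turn B (proj₂ (lastOf (e , d) as)) d' v (proj₁ (lastOf (e , d) as)) e → ⊥
  noRepetition e down down as lk u e∉ t s _ = noReturn (e , down) as lk (¬Any⇒All¬ _ e∉ ∷ u) s t
  noRepetition e upw upw as lk u e∉ t s _ = noReturn (e , upw) as lk (¬Any⇒All¬ _ e∉ ∷ u) s t
  noRepetition e down upw as lk u e∉ t s tr = noReversal e down upw as (λ ()) refl lk u t s tr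
  noRepetition e upw down as lk u e∉ t s tr = noReversal e upw down as (λ ()) refl lk u t s tr

  aiPath-unique : ∀ w → Linked (Link B) w → Unique (edges B w)
  aiPath-unique [] _ = []
  aiPath-unique (x ∷ w) lk with aiPath-unique w (Linked.tail lk) | DecMembership._∈?_ decE (proj₁ x) (edges B w)
  ... | u | no x∉ = ¬Any⇒All¬ (edges B w) x∉ ∷ u
  ... | u | yes x∈ with ∈-map⁻ proj₁ x∈
  ...   | (e' , d') , y∈ , refl with ∈-∃++ y∈
  ...     | as , bs , refl with splitLinked as bs lk | uniqueSplit (e' , d') as bs u
  ...       | lk' , (v , t , s , tr) | uas , e∉ = ⊥-elim (noRepetition e' (proj₂ x) d' as lk' uas e∉ t s tr)

  unique-length : ∀ (ys zs : List E) → Unique ys → (∀ {y} → y ∈ ys → y ∈ zs) → length ys ≤ length zs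
  unique-length [] zs _ _ = z≤n
  unique-length (y ∷ ys) zs (y∉ys ∷ u) sub with ∈-∃++ (sub (here refl))
  ... | as , bs , refl = subst (suc (length ys) ≤_) (sym (length-++-sucʳ as y bs))
        (s≤s (unique-length ys (as ++ bs) u λ {z} m → remove z (All.lookup y∉ys m) (sub (there m))))
    where
    remove : ∀ z → y ≢ z → z ∈ as ++ y ∷ bs → z ∈ as ++ bs
    remove z ne m with ∈-++⁻ as m
    ... | inj₁ m' = ∈-++⁺ˡ m'
    ... | inj₂ (here p) = ⊥-elim (ne (sym p))
    ... | inj₂ (there m') = ∈-++⁺ʳ as m'

  N : ℕ
  N = length xs

  aiPath-length : ∀ w → AiPath B w → length w ≤ N
  aiPath-length (x ∷ w) ap = subst (_≤ N) (length-map proj₁ (x ∷ w))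
    (unique-length (edges B (x ∷ w)) xs (aiPath-unique (x ∷ w) ap) (λ {y} _ → all∈ y))

  orientedEdges : List ED
  orientedEdges = concatMap (λ e → (e , down) ∷ (e , upw) ∷ []) xs

  orientedEdges-∈ : ∀ x → x ∈ orientedEdges
  orientedEdges-∈ (e , down) = ∈-concatMap⁺ _ (lose (all∈ e) (here refl))
  orientedEdges-∈ (e , upw) = ∈-concatMap⁺ _ (lose (all∈ e) (there (here refl)))

  walksUpTo : ℕ → List (List ED)
  walksUpTo zero = [] ∷ []
  walksUpTo (suc n) = [] ∷ concatMap (λ a → map (a ∷_) (walksUpTo n)) orientedEdges

  walksUpTo-∈ : ∀ n w → length w ≤ n → w ∈ walksUpTo n
  walksUpTo-∈ zero [] _ = here refl
  walksUpTo-∈ (suc n) [] _ = here refl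
  walksUpTo-∈ (suc n) (a ∷ w) (s≤s le) =
    there (∈-concatMap⁺ _ (lose (orientedEdges-∈ a) (∈-map⁺ (a ∷_) (walksUpTo-∈ n w le))))

  sharedVertex? : (m m' : Maybe V) (P : V → Set) → (∀ v → Dec (P v)) → Dec (Σ V λ v → m ≡ just v × m' ≡ just v × P v)
  sharedVertex? nothing m' P P? = no λ { (v , () , _) }
  sharedVertex? (just v) m' P P? with Maybe.≡-dec decV m' (just v) | P? v
  ... | yes p | yes q = yes (v , refl , p , q)
  ... | no n | _ = no λ { (v' , refl , p , q) → n p }
  ... | yes _ | no n = no λ { (v' , refl , p , q) → n q }

  turn? : ∀ d d' v e e' → Dec (Turn B d d' v e e')
  turn? down down v e e' = yes tt
  turn? upw upw v e e' = yes tt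
  turn? upw down v e e' with isInt? (kind v) | decE e e'
  ... | yes k | no ne = yes (k , ne)
  ... | no n | _ = no λ p → n (proj₁ p)
  ... | yes _ | yes q = no λ p → proj₂ p q
  turn? down upw v e e' with isCoint? (kind v) | decE e e'
  ... | yes k | no ne = yes (k , ne)
  ... | no n | _ = no λ p → n (proj₁ p)
  ... | yes _ | yes q = no λ p → proj₂ p q

  link? : ∀ x y → Dec (Link B x y)
  link? (e , d) (e' , d') = sharedVertex? (tgt B (e , d)) (src B (e' , d')) _ λ v → turn? d d' v e e'

  aiPath? : ∀ w → Dec (AiPath B w)
  aiPath? [] = no λ ()
  aiPath? (x ∷ w) = Linked.linked? link? (x ∷ w)

  Extends : List ED → List ED → Set
  Extends w w' = AiPath B w' × All (_∈ edges B w') (edges B w) × length w < length w'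

  extends? : ∀ w w' → Dec (Extends w w')
  extends? w w' with aiPath? w' | all? (λ e → DecMembership._∈?_ decE e (edges B w')) (edges B w) | length w <? length w'
  ... | yes a | yes b | yes c = yes (a , b , c)
  ... | no n | _ | _ = no λ p → n (proj₁ p)
  ... | yes _ | no n | _ = no λ p → n (proj₁ (proj₂ p))
  ... | yes _ | yes _ | no n = no λ p → n (proj₂ (proj₂ p))

  -- Extend an ai-path as long as some candidate extends it; lengths are
  -- bounded by N, so after at most N steps the path is maximal.
  maximise : (k : ℕ) (w : List ED) → AiPath B w → N ≤ length w + k →
    Σ (List ED) λ w* → MaximalAiPath B w* × (∀ {e} → e ∈ edges B w → e ∈ edges B w*)
  maximise zero w ap le =
    w , (ap , λ w' ap' _ → ≤-trans (aiPath-length w' ap') (subst (N ≤_) (+-identityʳ _) le)) , λ m → m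
  maximise (suc k) w ap le with any? (extends? w) (walksUpTo N)
  ... | yes ext with satisfied ext
  ...   | w' , (ap' , sub , lt) with maximise k w' ap' (≤-trans le (subst (_≤ length w' + k) (sym (+-suc (length w) k)) (+-monoˡ-≤ k lt)))
  ...     | w* , mx , sub' = w* , mx , λ m → sub' (All.lookup sub m)
  maximise (suc k) w ap le | no none = w , (ap , maximal) , λ m → m
    where
    maximal : ∀ w' → AiPath B w' → (∀ {e} → e ∈ edges B w → e ∈ edges B w') → length w' ≤ length w
    maximal w' ap' sub with length w <? length w'
    ... | yes lt = ⊥-elim (none (lose (walksUpTo-∈ N w' (aiPath-length w' ap')) (ap' , All.tabulate sub , lt)))
    ... | no nlt = ≮⇒≥ nlt

  lastSimple : ∀ w → Any (λ x → SimpleEdge B (proj₁ x)) w →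
    Σ (List ED) λ pre → Σ E λ e → Σ (Dir B) λ d → Σ (List ED) λ post →
      (w ≡ pre ++ (e , d) ∷ post) × SimpleEdge B e × All (λ x → ¬ SimpleEdge B (proj₁ x)) post
  lastSimple (x ∷ w) s with any? (simple? ∘ proj₁) w
  ... | yes s' with lastSimple w s'
  ...   | pre , e , d , post , eq , se , none = x ∷ pre , e , d , post , cong (x ∷_) eq , se , none
  lastSimple (x ∷ w) (here s) | no n = [] , proj₁ x , proj₂ x , w , refl , s , ¬Any⇒All¬ w n
  lastSimple (x ∷ w) (there s) | no n = ⊥-elim (n s)

  extremalEdge : (e₀ : E) → SimpleEdge B e₀ → Σ E λ e → Extremal B e
  extremalEdge e₀ s₀ with maximise N ((e₀ , down) ∷ []) [-] (m≤n+m N 1)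
  ... | w* , mx , sub with ∈-map⁻ proj₁ (sub (here refl))
  ...   | x , x∈ , refl with lastSimple w* (lose x∈ s₀)
  ...     | pre , e , d , post , refl , s , none = e , s , pre , d , post , mx , clean _ (proj₁ mx) , none

-- The invariant of the induction: every directed interface connection of D
-- (from an interaction to a lower edge, from an upper to a lower edge, from
-- an upper edge to a cointeraction) is traced by an ai-walk of F with the
-- same ends, and F and D carry the same polarities on their interface.
record Traced {H K : Set} (F D : Flow H K) : Set where
  field
    intAbove   : ∀ j → Paths.IntAbove D j → Paths.AiIntAbove F j
    through    : ∀ i j → Paths.Through D i j → Paths.AiThrough F i j
    cointBelow : ∀ i → Paths.CointBelow D i → Paths.AiCointBelow F i
    pol-inp    : ∀ i → Flow.pol D (Flow.inp D i) ≡ Flow.pol F (Flow.inp F i)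
    pol-out    : ∀ j → Flow.pol D (Flow.out D j) ≡ Flow.pol F (Flow.out F j)

Rewriting : {H K : Set} → Flow H K → Set₁
Rewriting {H} {K} B = Σ (Flow H K) λ C → IsFlow C × Paths.NoConn C × (B →ex C) × Traced B C

rewriting-noSimple : {H K : Set} (B : Flow H K) → IsFlow B → AllClean B → (∀ e → ¬ SimpleEdge B e) → Rewriting B
rewriting-noSimple B isF clean none = B , isF , noConn , noExtremal (λ e ext → none e (proj₁ ext)) , traced
  where
  open Paths B
  noConn : NoConn
  noConn e l ir r cb = none e (simple← ir (subst CointBot (sym (cleanConnection clean ir r cb)) cb))
  traced : Traced B B
  traced = record
    { intAbove = λ j (e , ir , r) → (e , down) , ir , reach⇒walk r
    ; through = λ i j r → reach⇒walk r
    ; cointBelow = λ i (l , r , cb) → l , cb , reach⇒walk r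
    ; pol-inp = λ _ → refl ; pol-out = λ _ → refl }

redexAt : {H K : Set} (B : Flow H K) → IsFlow B → (e : Flow.E B) → SimpleEdge B e → Σ (Redex B) λ r → Redex.ε₁ r ≡ e
redexAt B isF e s with Paths.simple→ B s
... | (ν , u , k) , (μ , l , k') =
  record { decV = finite⇒decEq finV ; decE = finite⇒decEq finE ; ν = ν ; μ = μ ; ε₁ = e
         ; ε₂ = proj₁ other₂ ; ε₃ = proj₁ other₃
         ; νint = k ; μco = k' ; ε₁up = u ; ε₁lo = l
         ; ε₂up = proj₁ (proj₂ other₂) ; ε₂≢ = proj₂ (proj₂ other₂)
         ; ε₃lo = proj₁ (proj₂ other₃) ; ε₃≢ = proj₂ (proj₂ other₃) } , refl
  where
  open Flow B
  open IsFlow isF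
  other₂ : Σ E λ b → up b ≡ inj₁ ν × b ≢ e
  other₂ = Exactly-2-other (subst (Exactly E (λ x → up x ≡ inj₁ ν)) (cong nLow k) (lowerDeg ν)) (finite⇒decEq finE) e
  other₃ : Σ E λ b → lo b ≡ inj₁ μ × b ≢ e
  other₃ = Exactly-2-other (subst (Exactly E (λ x → lo x ≡ inj₁ μ)) (cong nUp k') (upperDeg μ)) (finite⇒decEq finE) e

module CombineStep {H K : Set} (B : Flow H K) (isF : IsFlow B) (clean : AllClean B)
  (r : Redex B) (ext : Extremal B (Redex.ε₁ r)) where
  open Flow B
  open Redex r
  open Split B r
  open SplitFacts B r isF
  module E' = EmbeddingFacts embed'
  module E'' = EmbeddingFacts embed''
  module BP = Paths B

  turn-at-μ : Link B (ε₃ , down) (ε₁ , upw)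
  turn-at-μ = μ , cong (vtx B) ε₃lo , cong (vtx B) ε₁lo , μco , ε₃≢

  bridge : ∀ {x y} → BP.Walk x (ε₃ , down) → BP.Walk (ε₂ , down) y → BP.Walk x y
  bridge {x} {y} w₁ w₂ = BP.walk-via {x} {ε₃ , down} {ε₁ , upw} {y} w₁ turn-at-μ (BP.wcons (link-next upw) w₂)

  -- An interaction above ε̃₃ in D' and a cointeraction below ε̂₂ in D''
  -- would make ε₃ and ε₂ simple edges of the clean flow B.
  noCrossing : ∀ {D' D''} → Traced B' D' → Traced B'' D'' →
    ¬ (Paths.IntAbove D' (inj₂ tt) × Paths.CointBelow D'' (inj₂ tt))
  noCrossing t' t'' (above , below)
    with Traced.intAbove t' (inj₂ tt) above | Traced.cointBelow t'' (inj₂ tt) below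
  ... | x , ird , w | l , cb , w₂
    with BP.walkFromInt⇒reach (E'.intRootDown-pres x ird) (E'.walk-pres w)
       | BP.walkToCoint⇒reach (E''.walk-pres w₂) (E''.cointBot-pres {l} cb)
  ... | e , ir , r | l' , r' , cb' = extremal⇒notBothSimple ext
    (BP.simple← ν-root (subst BP.CointBot (sym (BP.cleanConnection clean ν-root r' cb')) cb'))
    (BP.simple← (subst BP.IntRoot (BP.cleanConnection clean ir r μ-bottom) ir) μ-bottom)
    where
    ν-root : BP.IntRoot ε₂
    ν-root = ν , ε₂up , νint
    μ-bottom : BP.CointBot ε₃
    μ-bottom = μ , ε₃lo , μco

  -- Directed interface connections of Comb(D', D'') lie in D', in D'', or
  -- cross from D' to D''; the traces in B' and B'' map into B, joined by
  -- the bridge in the crossing case.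
  traced-comb : ∀ {D' D''} (isD' : IsFlow D') (isD'' : IsFlow D'') → Traced B' D' → Traced B'' D'' → Traced B (Comb D' D'')
  traced-comb {D'} {D''} isD' isD'' t' t'' = record
    { intAbove = intAbove ; through = through ; cointBelow = cointBelow
    ; pol-inp = T'.pol-inp ; pol-out = T''.pol-out }
    where
    module T' = Traced t'
    module T'' = Traced t''
    open CombFacts D' D'' isD' isD'' using (combIntAbove; combThrough; combCointBelow)
    intAbove : ∀ j → Paths.IntAbove (Comb D' D'') j → BP.AiIntAbove j
    intAbove j above with combIntAbove j above
    ... | inj₁ a with T'.intAbove (inj₁ j) a
    ...   | x , ird , w = E'.φx x , E'.intRootDown-pres x ird , E'.walk-pres w
    intAbove j above | inj₂ (inj₁ a) with T''.intAbove j a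
    ...   | x , ird , w = E''.φx x , E''.intRootDown-pres x ird , E''.walk-pres w
    intAbove j above | inj₂ (inj₂ (a , t)) with T'.intAbove (inj₂ tt) a
    ...   | x , ird , w = E'.φx x , E'.intRootDown-pres x ird , bridge (E'.walk-pres w) (E''.walk-pres (T''.through (inj₂ tt) j t))
    through : ∀ i j → Paths.Through (Comb D' D'') i j → BP.AiThrough i j
    through i j t with combThrough i j t
    ... | inj₁ a = E'.walk-pres (T'.through i (inj₁ j) a)
    ... | inj₂ (inj₁ a) = E''.walk-pres (T''.through (inj₁ i) j a)
    ... | inj₂ (inj₂ (a , b)) = bridge (E'.walk-pres (T'.through i (inj₂ tt) a)) (E''.walk-pres (T''.through (inj₂ tt) j b))
    cointBelow : ∀ i → Paths.CointBelow (Comb D' D'') i → BP.AiCointBelow i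
    cointBelow i below with combCointBelow i below
    ... | inj₁ a with T'.cointBelow i a
    ...   | l , cb , w = proj₁ l , E'.cointBot-pres {l} cb , E'.walk-pres w
    cointBelow i below | inj₂ (inj₁ a) with T''.cointBelow (inj₁ i) a
    ...   | l , cb , w = proj₁ l , E''.cointBot-pres {l} cb , E''.walk-pres w
    cointBelow i below | inj₂ (inj₂ (a , b)) with T''.cointBelow (inj₂ tt) b
    ...   | l , cb , w = proj₁ l , E''.cointBot-pres {l} cb , bridge (E'.walk-pres (T'.through i (inj₂ tt) a)) (E''.walk-pres w)

  combine : Rewriting B' → Rewriting B'' → Rewriting B
  combine (D' , isD' , ncD' , exD' , t') (D'' , isD'' , ncD'' , exD'' , t'') =
    Comb D' D'' , CF.WithMatchingPolarities.isFlow-comb pol-inp pol-out pol-slot ,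
    CF.noConn-comb ncD' ncD'' (noCrossing t' t'') , split r ext exD' exD'' , traced-comb isD' isD'' t' t''
    where
    module CF = CombFacts D' D'' isD' isD''
    module T' = Traced t'
    module T'' = Traced t''
    pol-inp : ∀ i → Flow.pol D'' (Flow.inp D'' (inj₁ i)) ≡ Flow.pol D' (Flow.inp D' i)
    pol-inp i = trans (T''.pol-inp (inj₁ i)) (sym (T'.pol-inp i))
    pol-out : ∀ j → Flow.pol D' (Flow.out D' (inj₁ j)) ≡ Flow.pol D'' (Flow.out D'' j)
    pol-out j = trans (T'.pol-out (inj₁ j)) (sym (T''.pol-out j))
    pol-slot : Flow.pol D' (Flow.out D' (inj₂ tt)) ≡ Flow.pol D'' (Flow.inp D'' (inj₂ tt))
    pol-slot = trans (T'.pol-out (inj₂ tt)) (trans (sym pol-ε₂≡ε₃) (sym (T''.pol-inp (inj₂ tt))))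

-- The main induction, on a bound n for the length of a list xs
-- enumerating the edges of B.
rewrite-flow : (n : ℕ) → {H K : Set} (B : Flow H K) → IsFlow B → CycleFree B → AllClean B →
  (xs : List (Flow.E B)) → (∀ e → e ∈ xs) → length xs ≤ n → Rewriting B
rewrite-flow n B isF cf clean xs all∈ le with DecideSimple.someSimple? B xs all∈
... | inj₂ none = rewriting-noSimple B isF clean none
... | inj₁ (e₀ , s₀) with FindExtremal.extremalEdge B cf clean decV decE xs all∈ e₀ s₀
  where
  decV : DecidableEquality (Flow.V B)
  decV = finite⇒decEq (IsFlow.finV isF)
  decE : DecidableEquality (Flow.E B)
  decE = finite⇒decEq (IsFlow.finE isF)
...   | e , ext with redexAt B isF e (proj₁ ext)
...     | r , refl = step n le
  where
  open SplitFacts B r isF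
  step : ∀ n → length xs ≤ n → Rewriting B
  step zero le' with ≤-trans (dropε₁-< xs (all∈ e)) le'
  ... | ()
  step (suc n') le' = CombineStep.combine B isF clean r ext
    (rewrite-flow n' (Split.B' B r) isFlow' (E'.cycleFree-refl cf) (E'.allClean-refl clean) ys ys-all smaller)
    (rewrite-flow n' (Split.B'' B r) isFlow'' (E''.cycleFree-refl cf) (E''.allClean-refl clean) ys ys-all smaller)
    where
    module E' = EmbeddingFacts embed'
    module E'' = EmbeddingFacts embed''
    ys : List (Split.EA B r)
    ys = dropε₁ xs
    ys-all : ∀ a → a ∈ ys
    ys-all a = dropε₁-∈ xs a (all∈ (proj₁ a))
    smaller : length ys ≤ n'
    smaller = ≤-pred (≤-trans (dropε₁-< xs (all∈ e)) le')

theorem5p12 : {H K : Set} (B : Flow H K) → IsFlow B → CycleFree B → AllClean B →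
    Σ (Flow H K) (λ C → IsFlow C × NoAiConnection C × (B →ex C))
theorem5p12 B isF cf clean with finite⇒listable (IsFlow.finE isF)
... | xs , all∈ with rewrite-flow (length xs) B isF cf clean xs all∈ ≤-refl
...   | C , isC , noConn , B→C , _ = C , isC , Paths.noConn⇒noAiConnection C noConn , B→C
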